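{- For an integer $k\ge 1$ let $T_k$ be the tree on $9k+4$ vertices constructed as follows: a vertex $v_0$ is adjacent to three vertices $v_1,v_2,v_3$; for each $i\in\{1,2,3\}$ and each $j\in\{1,\dots,k\}$ there are vertices $x_{ij},y_{ij},z_{ij}$ with edges $v_ix_{ij}$, $x_{ij}y_{ij}$, $y_{ij}z_{ij}$ (so below each $v_i$ hang $k$ paths on three vertices, attached at one end). If $k\ge 4$, then the domination polynomial $D(T_k,x)$ is not log-concave.
   Context: A dominating set of a graph $G=(V,E)$ is a set $S\subseteq V$ such that every vertex is in $S$ or adjacent to a vertex of $S$. If $d_i$ is the number of dominating sets of $G$ of cardinality $i$ and $|V|=n$, the domination polynomial is $D(G,x)=\sum_{i=0}^n d_ix^i$. A polynomial $a_0+a_1x+\cdots+a_nx^n$ is log-concave if $a_i^2\ge a_{i-1}a_{i+1}$ for every $1\le i\le n-1$. -}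

module Defs where

open import Data.Nat using (ℕ; zero; suc; _+_; _*_; _∸_; _≤_; pred; _≡ᵇ_; _/_; _%_)
open import Data.Bool using (Bool; true; false; _∧_; _∨_; T)
open import Data.Fin using (Fin; toℕ)
open import Data.Fin.Subset using (Subset; _∈_; ∣_∣)
open import Data.Fin.Subset.Properties using (_∈?_)
open import Data.Fin.Properties using (all?; any?)
open import Data.Vec using (Vec; []; _∷_)
open import Data.List using (List; []; _∷_; map; _++_; length; filter)
open import Data.Product using (Σ; _×_; _,_)
open import Data.Sum using (_⊎_)
open import Relation.Nullary using (Dec)
open import Relation.Nullary.Decidable using (_⊎-dec_; _×-dec_)
open import Relation.Binary.PropositionalEquality using (_≡_; refl)
open import Data.Bool.Properties using (∨-comm)
import Data.Nat as ℕ

record Graph (n : ℕ) : Set where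
  field
    adj   : Fin n → Fin n → Bool
    sym   : ∀ u v → adj u v ≡ adj v u
    irrefl : ∀ v → adj v v ≡ false
open Graph public

Dominating : ∀ {n} → Graph n → Subset n → Set
Dominating {n} G S = ∀ (v : Fin n) → v ∈ S ⊎ Σ (Fin n) (λ u → u ∈ S × T (adj G u v))

dominating? : ∀ {n} (G : Graph n) (S : Subset n) → Dec (Dominating G S)
dominating? G S = all? λ v → (v ∈? S) ⊎-dec any? (λ u → (u ∈? S) ×-dec Data.Bool.T? (adj G u v))
  where import Data.Bool

allSubsets : (n : ℕ) → List (Subset n)
allSubsets zero = [] ∷ []
allSubsets (suc n) = map (false ∷_) (allSubsets n) ++ map (true ∷_) (allSubsets n)

domCoeff : ∀ {n} → Graph n → ℕ → ℕ
domCoeff {n} G i =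
  length (filter (λ S → dominating? G S ×-dec (∣ S ∣ ℕ.≟ i)) (allSubsets n))

LogConcave : ℕ → (ℕ → ℕ) → Set
LogConcave n a = ∀ i → 1 ≤ i → i ≤ n ∸ 1 → a (pred i) * a (suc i) ≤ a i * a i

DomPolyLogConcave : ∀ {n} → Graph n → Set
DomPolyLogConcave {n} G = LogConcave n (domCoeff G)

-- The tree T_k on 9k+4 vertices.
-- Vertex labels: root = v_0, leg i = v_{i+1} (i = 0,1,2),
-- pathv i j t = x_{i+1,j+1}, y_{i+1,j+1}, z_{i+1,j+1} for t = 0,1,2.

data TLabel : Set where
  root  : TLabel
  leg   : ℕ → TLabel
  pathv : ℕ → ℕ → ℕ → TLabel

-- Numbering of vertices: 0 ↦ v_0, 1,2,3 ↦ v_1,v_2,v_3,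
-- 4 + 9j + 3i + t ↦ pathv i j t  (0 ≤ i,t ≤ 2, 0 ≤ j < k).
decode : ℕ → TLabel
decode zero = root
decode (suc zero) = leg 0
decode (suc (suc zero)) = leg 1
decode (suc (suc (suc zero))) = leg 2
decode (suc (suc (suc (suc r)))) = pathv ((r % 9) / 3) (r / 9) ((r % 9) % 3)

edge : TLabel → TLabel → Bool
edge root (leg _) = true
edge (leg i) (pathv i' _ zero) = i ≡ᵇ i'
edge (pathv i j zero) (pathv i' j' (suc zero)) = (i ≡ᵇ i') ∧ (j ≡ᵇ j')
edge (pathv i j (suc zero)) (pathv i' j' (suc (suc zero))) = (i ≡ᵇ i') ∧ (j ≡ᵇ j')
edge _ _ = false

tadj : ℕ → ℕ → Bool
tadj a b = edge (decode a) (decode b) ∨ edge (decode b) (decode a)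


private
  edge-irrefl : ∀ l → edge l l ≡ false
  edge-irrefl root = refl
  edge-irrefl (leg _) = refl
  edge-irrefl (pathv _ _ zero) = refl
  edge-irrefl (pathv _ _ (suc zero)) = refl
  edge-irrefl (pathv _ _ (suc (suc zero))) = refl
  edge-irrefl (pathv _ _ (suc (suc (suc _)))) = refl

  tadj-irrefl : ∀ a → tadj a a ≡ false
  tadj-irrefl a rewrite edge-irrefl (decode a) = refl

Tk : (k : ℕ) → Graph (9 * k + 4)
Tk k = record
  { adj    = λ u v → tadj (toℕ u) (toℕ v)
  ; sym    = λ u v → ∨-comm (edge (decode (toℕ u)) (decode (toℕ v))) _
  ; irrefl = λ v → tadj-irrefl (toℕ v)
  }

-- Encode a vertex subset of T_k by the bits of v₀, v₁, v₂, v₃ followed by k blocks, block j holding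
-- x, y, z of the j-th path under each leg. Domination is then a conjunction of local conditions on
-- the root bits and on each block, and every path must contain y or z, so a dominating set has at
-- least 3k + 1 vertices and {v₀} ∪ {yᵢⱼ} attains this. Sorting dominating sets by their root bits and
-- counting admissible blocks gives d_{3k+1} ≥ 1, d_{3k+2} ≤ 9k + 3·2^k (v₀ with one block of four
-- vertices, or v₀ and one leg) and d_{3k+3} ≥ 8^k + 6k·4^k (all three legs, or two legs with one x
-- covering the third). For k ≥ 4 and p = 2^(k-1) these give d_{3k+2}² ≤ 144p² < 160p² ≤ d_{3k+1} d_{3k+3}.

module Submission where

open import Defs hiding (sym)
open import Data.Bool using (Bool; true; false; T; T?; not; _∧_; _∨_)
open import Data.Bool.Properties using (T-≡; T-∧; T-∨)
open import Data.Empty using (⊥; ⊥-elim)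
open import Data.Fin using (Fin; toℕ; fromℕ<)
import Data.Fin.Properties as Fin
open import Data.Fin.Subset using (Subset; ∣_∣) renaming (_∈_ to _∈ₛ_)
open import Data.List using (List; []; _∷_; [_]; length; filter; cartesianProductWith)
  renaming (_++_ to _++ₗ_; map to mapₗ; concat to concatₗ)
import Data.List.Properties as List
open import Data.List.Membership.Propositional using (_∈_)
import Data.List.Membership.Propositional.Properties as ∈
open import Data.List.Relation.Binary.Disjoint.Propositional using (Disjoint)
open import Data.List.Relation.Binary.Subset.Propositional using (_⊆_)
open import Data.List.Relation.Unary.All as All using (All; []; _∷_)
open import Data.List.Relation.Unary.AllPairs using (AllPairs; []; _∷_)
open import Data.List.Relation.Unary.Any using (here; there)
open import Data.List.Relation.Unary.Unique.Propositional using (Unique)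
import Data.List.Relation.Unary.Unique.Propositional.Properties as Unique
open import Data.Nat using (ℕ; zero; suc; _+_; _*_; _^_; _∸_; _≤_; _<_; z≤n; s≤s; _≟_; _≡ᵇ_; NonZero; _/_; _%_)
import Data.Nat.ListAction as ListAction
open import Data.Nat.DivMod
open import Data.Nat.Properties
open import Data.Nat.Tactic.RingSolver using (solve-∀)
open import Data.Product using (Σ; Σ-syntax; _×_; _,_; proj₁; proj₂)
open import Data.Sum using (_⊎_; inj₁; inj₂)
import Data.Sum as Sum
open import Data.Vec as Vec using (Vec; []; _∷_; _++_; concat; sum; map; lookup; splitAt; group)
import Data.Vec.Properties as Vec
open import Data.Vec.Membership.Propositional using (lose)
open import Data.Vec.Membership.Propositional.Properties using (∈-lookup)
open import Data.Vec.Relation.Unary.All as VAll using ([]; _∷_) renaming (All to VAll)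
import Data.Vec.Relation.Unary.All.Properties as VAll
open import Data.Vec.Relation.Unary.Any as VAny using (here; there) renaming (Any to VAny)
import Data.Vec.Relation.Unary.Any.Properties as VAny
open import Function.Base using (_∘_; _∘′_)
open import Function.Bundles using (_⇔_; mk⇔; Equivalence)
import Function.Properties.Equivalence as ⇔
open import Relation.Binary.PropositionalEquality using (_≡_; _≢_; refl; cong; cong₂; subst; sym; trans; module ≡-Reasoning)
open import Relation.Nullary using (¬_; Dec; yes; no)
open import Relation.Nullary.Decidable using (_×-dec_)

module _ {A : Set} where

  private
    remove : ∀ {x : A} ys → x ∈ ys → List A
    remove (_ ∷ ys) (here _)  = ys
    remove (y ∷ ys) (there p) = y ∷ remove ys p

    length-remove : ∀ {x : A} ys (p : x ∈ ys) → length ys ≡ suc (length (remove ys p))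
    length-remove (_ ∷ ys) (here _)  = refl
    length-remove (y ∷ ys) (there p) = cong suc (length-remove ys p)

    ∈-remove : ∀ {x y : A} {ys} (p : x ∈ ys) → y ∈ ys → x ≢ y → y ∈ remove ys p
    ∈-remove (here refl) (here refl) x≢y = ⊥-elim (x≢y refl)
    ∈-remove (here refl) (there q)   _   = q
    ∈-remove (there p)   (here refl) _   = here refl
    ∈-remove (there p)   (there q)   x≢y = there (∈-remove p q x≢y)

  Unique-⊆⇒length≤ : ∀ {xs ys : List A} → Unique xs → xs ⊆ ys → length xs ≤ length ys
  Unique-⊆⇒length≤ [] _ = z≤n
  Unique-⊆⇒length≤ {x ∷ _} {ys} (x∉xs ∷ u) xs⊆ys =
    subst (_ ≤_) (sym (length-remove ys x∈ys))
      (s≤s (Unique-⊆⇒length≤ u λ y∈xs → ∈-remove x∈ys (xs⊆ys (there y∈xs)) (All.lookup x∉xs y∈xs)))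
    where
    x∈ys : x ∈ ys
    x∈ys = xs⊆ys (here refl)

length-cartesianProductWith : ∀ {A B C : Set} (f : A → B → C) xs ys →
  length (cartesianProductWith f xs ys) ≡ length xs * length ys
length-cartesianProductWith f []       ys = refl
length-cartesianProductWith f (x ∷ xs) ys = begin
  length (mapₗ (f x) ys ++ₗ cartesianProductWith f xs ys)  ≡⟨ List.length-++ (mapₗ (f x) ys) ⟩
  length (mapₗ (f x) ys) + length (cartesianProductWith f xs ys)
    ≡⟨ cong₂ _+_ (List.length-map (f x) ys) (length-cartesianProductWith f xs ys) ⟩
  length ys + length xs * length ys  ∎
  where open ≡-Reasoning

length-concat : ∀ {A : Set} (xss : List (List A)) → length (concatₗ xss) ≡ ListAction.sum (mapₗ length xss)
length-concat []         = refl
length-concat (xs ∷ xss) = trans (List.length-++ xs) (cong (length xs +_) (length-concat xss))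

module _ {A : Set} where

  tuples : List A → (k : ℕ) → List (Vec A k)
  tuples B zero    = [ [] ]
  tuples B (suc k) = cartesianProductWith _∷_ B (tuples B k)

  tuplesWithOne : List A → List A → (k : ℕ) → List (Vec A k)
  tuplesWithOne B₀ B₁ zero    = []
  tuplesWithOne B₀ B₁ (suc k) =
    cartesianProductWith _∷_ B₁ (tuples B₀ k) ++ₗ cartesianProductWith _∷_ B₀ (tuplesWithOne B₀ B₁ k)

  length-tuples : ∀ B k → length (tuples B k) ≡ length B ^ k
  length-tuples B zero    = refl
  length-tuples B (suc k) =
    trans (length-cartesianProductWith _∷_ B (tuples B k)) (cong (length B *_) (length-tuples B k))

  private
    length-tuplesWithOne-suc : ∀ B₀ B₁ k → length (tuplesWithOne B₀ B₁ (suc k)) ≡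
      length B₁ * length B₀ ^ k + length B₀ * length (tuplesWithOne B₀ B₁ k)
    length-tuplesWithOne-suc B₀ B₁ k = begin
      length (tuplesWithOne B₀ B₁ (suc k))
        ≡⟨ List.length-++ (cartesianProductWith _∷_ B₁ (tuples B₀ k)) ⟩
      length (cartesianProductWith _∷_ B₁ (tuples B₀ k)) + length (cartesianProductWith _∷_ B₀ (tuplesWithOne B₀ B₁ k))
        ≡⟨ cong₂ _+_ (trans (length-cartesianProductWith _∷_ B₁ (tuples B₀ k)) (cong (length B₁ *_) (length-tuples B₀ k)))
                     (length-cartesianProductWith _∷_ B₀ (tuplesWithOne B₀ B₁ k)) ⟩
      length B₁ * length B₀ ^ k + length B₀ * length (tuplesWithOne B₀ B₁ k)  ∎
      where open ≡-Reasoning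

  length-tuplesWithOne : ∀ B₀ B₁ k →
    length (tuplesWithOne B₀ B₁ (suc k)) ≡ suc k * (length B₁ * length B₀ ^ k)
  length-tuplesWithOne B₀ B₁ zero =
    trans (length-tuplesWithOne-suc B₀ B₁ zero) (arith (length B₀) (length B₁))
    where
    arith : ∀ b₀ b₁ → b₁ * 1 + b₀ * 0 ≡ 1 * (b₁ * 1)
    arith = solve-∀
  length-tuplesWithOne B₀ B₁ (suc k) = begin
    length (tuplesWithOne B₀ B₁ (suc (suc k)))
      ≡⟨ length-tuplesWithOne-suc B₀ B₁ (suc k) ⟩
    b₁ * (b₀ * b₀ ^ k) + b₀ * length (tuplesWithOne B₀ B₁ (suc k))
      ≡⟨ cong (λ ℓ → b₁ * (b₀ * b₀ ^ k) + b₀ * ℓ) (length-tuplesWithOne B₀ B₁ k) ⟩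
    b₁ * (b₀ * b₀ ^ k) + b₀ * (suc k * (b₁ * b₀ ^ k))
      ≡⟨ arith b₀ b₁ (b₀ ^ k) k ⟩
    suc (suc k) * (b₁ * (b₀ * b₀ ^ k))  ∎
    where
    open ≡-Reasoning
    b₀ b₁ : ℕ
    b₀ = length B₀
    b₁ = length B₁
    arith : ∀ b₀ b₁ p k → b₁ * (b₀ * p) + b₀ * (suc k * (b₁ * p)) ≡ suc (suc k) * (b₁ * (b₀ * p))
    arith = solve-∀

  Unique-tuples : ∀ {B} k → Unique B → Unique (tuples B k)
  Unique-tuples zero    _ = All.[] ∷ []
  Unique-tuples (suc k) u = Unique.cartesianProductWith⁺ _∷_ Vec.∷-injective u (Unique-tuples k u)

  ∈-tuples⁺ : ∀ {B k} {bs : Vec A k} → VAll (_∈ B) bs → bs ∈ tuples B k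
  ∈-tuples⁺ []          = here refl
  ∈-tuples⁺ (b∈B ∷ bs∈) = ∈.∈-cartesianProductWith⁺ _∷_ b∈B (∈-tuples⁺ bs∈)

  ∈-tuples⁻ : ∀ {B} k {bs : Vec A k} → bs ∈ tuples B k → VAll (_∈ B) bs
  ∈-tuples⁻ zero    {[]} _ = []
  ∈-tuples⁻ {B} (suc k) p with ∈.∈-cartesianProductWith⁻ _∷_ B (tuples B k) p
  ... | _ , _ , b∈B , bs∈ , refl = b∈B ∷ ∈-tuples⁻ k bs∈

  Unique-tuplesWithOne : ∀ {B₀ B₁} k → Unique B₀ → Unique B₁ → Disjoint B₀ B₁ →
                         Unique (tuplesWithOne B₀ B₁ k)
  Unique-tuplesWithOne zero _ _ _ = []
  Unique-tuplesWithOne {B₀} {B₁} (suc k) u₀ u₁ B₀#B₁ =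
    Unique.++⁺ (Unique.cartesianProductWith⁺ _∷_ Vec.∷-injective u₁ (Unique-tuples k u₀))
               (Unique.cartesianProductWith⁺ _∷_ Vec.∷-injective u₀ (Unique-tuplesWithOne k u₀ u₁ B₀#B₁))
               heads-differ
    where
    heads-differ : Disjoint (cartesianProductWith _∷_ B₁ (tuples B₀ k))
                            (cartesianProductWith _∷_ B₀ (tuplesWithOne B₀ B₁ k))
    heads-differ (p , q)
      with ∈.∈-cartesianProductWith⁻ _∷_ B₁ (tuples B₀ k) p
         | ∈.∈-cartesianProductWith⁻ _∷_ B₀ (tuplesWithOne B₀ B₁ k) q
    ... | _ , _ , b∈B₁ , _ , refl | _ , _ , b∈B₀ , _ , refl = B₀#B₁ (b∈B₀ , b∈B₁)

  ∈-tuplesWithOne⁻ : ∀ {B₀ B₁} k {bs : Vec A k} → bs ∈ tuplesWithOne B₀ B₁ k →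
                     VAll (λ b → b ∈ B₀ ⊎ b ∈ B₁) bs × VAny (_∈ B₁) bs
  ∈-tuplesWithOne⁻ {B₀} {B₁} (suc k) p with ∈.∈-++⁻ (cartesianProductWith _∷_ B₁ (tuples B₀ k)) p
  ... | inj₁ p₁ with ∈.∈-cartesianProductWith⁻ _∷_ B₁ (tuples B₀ k) p₁
  ...   | _ , _ , b∈B₁ , bs∈ , refl = inj₂ b∈B₁ ∷ VAll.map inj₁ (∈-tuples⁻ k bs∈) , here b∈B₁
  ∈-tuplesWithOne⁻ {B₀} {B₁} (suc k) p | inj₂ p₀ with ∈.∈-cartesianProductWith⁻ _∷_ B₀ (tuplesWithOne B₀ B₁ k) p₀
  ...   | _ , _ , b∈B₀ , bs∈ , refl =
    let all , any = ∈-tuplesWithOne⁻ k bs∈ in inj₁ b∈B₀ ∷ all , there any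

private
  +-≤-≡⇒≡ : ∀ {x y a b} → a ≤ x → b ≤ y → x + y ≡ a + b → x ≡ a × y ≡ b
  +-≤-≡⇒≡ {x} {y} {a} {b} a≤x b≤y x+y≡a+b = x≡a , +-cancelˡ-≡ a y b (trans (cong (_+ y) (sym x≡a)) x+y≡a+b)
    where
    x≡a : x ≡ a
    x≡a = ≤-antisym (+-cancelʳ-≤ y x a (≤-trans (≤-reflexive x+y≡a+b) (+-monoʳ-≤ a b≤y))) a≤x

module _ {A : Set} (w : A → ℕ) where

  sum-map-const : ∀ {m k} {bs : Vec A k} → VAll (λ b → w b ≡ m) bs → sum (map w bs) ≡ k * m
  sum-map-const []          = refl
  sum-map-const (wb≡m ∷ ws) = cong₂ _+_ wb≡m (sum-map-const ws)

  sum-map-≥ : ∀ {m k} {bs : Vec A k} → VAll (λ b → m ≤ w b) bs → k * m ≤ sum (map w bs)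
  sum-map-≥ []          = z≤n
  sum-map-≥ (m≤wb ∷ ws) = +-mono-≤ m≤wb (sum-map-≥ ws)

  sum-map-tight : ∀ {m k} {bs : Vec A k} → VAll (λ b → m ≤ w b) bs →
                  sum (map w bs) ≡ k * m → VAll (λ b → w b ≡ m) bs
  sum-map-tight []          _ = []
  sum-map-tight (m≤wb ∷ ws) s =
    let wb≡m , rest = +-≤-≡⇒≡ m≤wb (sum-map-≥ ws) s in wb≡m ∷ sum-map-tight ws rest

  sum-map-tuplesWithOne : ∀ {m B₀ B₁} → (∀ {b} → b ∈ B₀ → w b ≡ m) → (∀ {b} → b ∈ B₁ → w b ≡ suc m) →
                          ∀ k {bs : Vec A k} → bs ∈ tuplesWithOne B₀ B₁ k → sum (map w bs) ≡ suc (k * m)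
  sum-map-tuplesWithOne {m} {B₀} {B₁} w₀ w₁ (suc k) p with ∈.∈-++⁻ (cartesianProductWith _∷_ B₁ (tuples B₀ k)) p
  ... | inj₁ p₁ with ∈.∈-cartesianProductWith⁻ _∷_ B₁ (tuples B₀ k) p₁
  ...   | _ , _ , b∈B₁ , bs∈ , refl =
    cong₂ _+_ (w₁ b∈B₁) (sum-map-const (VAll.map w₀ (∈-tuples⁻ k bs∈)))
  sum-map-tuplesWithOne {m} {B₀} {B₁} w₀ w₁ (suc k) p | inj₂ p₀
    with ∈.∈-cartesianProductWith⁻ _∷_ B₀ (tuplesWithOne B₀ B₁ k) p₀
  ...   | _ , _ , b∈B₀ , bs∈ , refl =
    trans (cong₂ _+_ (w₀ b∈B₀) (sum-map-tuplesWithOne w₀ w₁ k bs∈)) (+-suc m (k * m))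

  module _ {P : A → Set} {m : ℕ} (P⇒m≤w : ∀ {b} → P b → m ≤ w b) where

    ∈-tuples⁺-tight : ∀ {B k} {bs : Vec A k} → (∀ {b} → P b → w b ≡ m → b ∈ B) →
                      VAll P bs → sum (map w bs) ≡ k * m → bs ∈ tuples B k
    ∈-tuples⁺-tight complete Ps s =
      ∈-tuples⁺ (VAll.map (λ (Pb , wb≡m) → complete Pb wb≡m) (VAll.zip (Ps , sum-map-tight (VAll.map P⇒m≤w Ps) s)))

    ∈-tuplesWithOne⁺ : ∀ {B₀ B₁ k} {bs : Vec A k} →
                       (∀ {b} → P b → w b ≡ m → b ∈ B₀) → (∀ {b} → P b → w b ≡ suc m → b ∈ B₁) →
                       VAll P bs → sum (map w bs) ≡ suc (k * m) → bs ∈ tuplesWithOne B₀ B₁ k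
    ∈-tuplesWithOne⁺ {B₀} {B₁} {suc k} {b ∷ bs} complete₀ complete₁ (Pb ∷ Ps) s with w b ≟ m
    ... | yes wb≡m =
      ∈.∈-++⁺ʳ (cartesianProductWith _∷_ B₁ (tuples B₀ k))
        (∈.∈-cartesianProductWith⁺ _∷_ (complete₀ Pb wb≡m)
          (∈-tuplesWithOne⁺ complete₀ complete₁ Ps
            (+-cancelˡ-≡ m _ _ (trans (cong (_+ sum (map w bs)) (sym wb≡m)) (trans s (sym (+-suc m (k * m))))))))
    ... | no wb≢m =
      let wb≡1+m , rest = +-≤-≡⇒≡ (≤∧≢⇒< (P⇒m≤w Pb) (λ m≡wb → wb≢m (sym m≡wb)))
                                  (sum-map-≥ (VAll.map P⇒m≤w Ps)) s
      in ∈.∈-++⁺ˡ (∈.∈-cartesianProductWith⁺ _∷_ (complete₁ Pb wb≡1+m) (∈-tuples⁺-tight complete₀ Ps rest))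

⟦_⟧ : Bool → ℕ
⟦ true  ⟧ = 1
⟦ false ⟧ = 0

weight : ∀ {n} → Vec Bool n → ℕ
weight []      = 0
weight (x ∷ v) = ⟦ x ⟧ + weight v

∣∣≡weight : ∀ {n} (S : Subset n) → ∣ S ∣ ≡ weight S
∣∣≡weight []          = refl
∣∣≡weight (true  ∷ S) = cong suc (∣∣≡weight S)
∣∣≡weight (false ∷ S) = ∣∣≡weight S

weight-++ : ∀ {m n} (xs : Vec Bool m) (ys : Vec Bool n) → weight (xs ++ ys) ≡ weight xs + weight ys
weight-++ []       ys = refl
weight-++ (x ∷ xs) ys = trans (cong (⟦ x ⟧ +_) (weight-++ xs ys)) (sym (+-assoc ⟦ x ⟧ (weight xs) (weight ys)))

weight-concat : ∀ {n k} (bs : Vec (Vec Bool n) k) → weight (concat bs) ≡ sum (map weight bs)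
weight-concat []       = refl
weight-concat (b ∷ bs) = trans (weight-++ b (concat bs)) (cong (weight b +_) (weight-concat bs))

allSubsets-complete : ∀ n (S : Subset n) → S ∈ allSubsets n
allSubsets-complete zero    []          = here refl
allSubsets-complete (suc n) (false ∷ S) = ∈.∈-++⁺ˡ (∈.∈-map⁺ (false ∷_) (allSubsets-complete n S))
allSubsets-complete (suc n) (true  ∷ S) =
  ∈.∈-++⁺ʳ (mapₗ (false ∷_) (allSubsets n)) (∈.∈-map⁺ (true ∷_) (allSubsets-complete n S))

Unique-allSubsets : ∀ n → Unique (allSubsets n)
Unique-allSubsets zero    = All.[] ∷ []
Unique-allSubsets (suc n) =
  Unique.++⁺ (Unique.map⁺ Vec.∷-injectiveʳ (Unique-allSubsets n)) (Unique.map⁺ Vec.∷-injectiveʳ (Unique-allSubsets n))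
             heads-differ
  where
  heads-differ : Disjoint (mapₗ (false ∷_) (allSubsets n)) (mapₗ (true ∷_) (allSubsets n))
  heads-differ (p , q) with ∈.∈-map⁻ (false ∷_) p | ∈.∈-map⁻ (true ∷_) q
  ... | _ , _ , refl | _ , _ , ()

bitAt : ∀ {n} → Vec Bool n → ℕ → Bool
bitAt []      _       = false
bitAt (x ∷ v) zero    = x
bitAt (x ∷ v) (suc p) = bitAt v p

bitAt-toℕ : ∀ {n} (S : Vec Bool n) (v : Fin n) → bitAt S (toℕ v) ≡ lookup S v
bitAt-toℕ (x ∷ S) Fin.zero    = refl
bitAt-toℕ (x ∷ S) (Fin.suc v) = bitAt-toℕ S v

bitAt-++ˡ : ∀ {m n} (xs : Vec Bool m) (ys : Vec Bool n) {c} → c < m → bitAt (xs ++ ys) c ≡ bitAt xs c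
bitAt-++ˡ (x ∷ xs) ys {zero}  _         = refl
bitAt-++ˡ (x ∷ xs) ys {suc c} (s≤s c<m) = bitAt-++ˡ xs ys c<m

bitAt-++ʳ : ∀ {m n} (xs : Vec Bool m) (ys : Vec Bool n) c → bitAt (xs ++ ys) (m + c) ≡ bitAt ys c
bitAt-++ʳ []       ys c = refl
bitAt-++ʳ (x ∷ xs) ys c = bitAt-++ʳ xs ys c

bitAt-concat : ∀ {n k} (bs : Vec (Vec Bool n) k) (j : Fin k) {c} → c < n →
               bitAt (concat bs) (toℕ j * n + c) ≡ bitAt (lookup bs j) c
bitAt-concat (b ∷ bs) Fin.zero    c<n = bitAt-++ˡ b (concat bs) c<n
bitAt-concat {n} (b ∷ bs) (Fin.suc j) {c} c<n = begin
  bitAt (b ++ concat bs) ((n + toℕ j * n) + c)  ≡⟨ cong (bitAt (b ++ concat bs)) (+-assoc n (toℕ j * n) c) ⟩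
  bitAt (b ++ concat bs) (n + (toℕ j * n + c))  ≡⟨ bitAt-++ʳ b (concat bs) (toℕ j * n + c) ⟩
  bitAt (concat bs) (toℕ j * n + c)             ≡⟨ bitAt-concat bs j c<n ⟩
  bitAt (lookup bs j) c                         ∎
  where open ≡-Reasoning

∈ₛ⇔bitAt : ∀ {n} (S : Subset n) (v : Fin n) → v ∈ₛ S ⇔ T (bitAt S (toℕ v))
∈ₛ⇔bitAt S v = mk⇔
  (λ v∈S → Equivalence.from T-≡ (trans (bitAt-toℕ S v) (Vec.[]=⇒lookup v∈S)))
  (λ bit → Vec.lookup⇒[]= v S (trans (sym (bitAt-toℕ S v)) (Equivalence.to T-≡ bit)))

module _ (R : ℕ → ℕ → Bool) where

  Dominated : ∀ {m} → Vec Bool m → ℕ → Set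
  Dominated {m} S p = T (bitAt S p) ⊎ Σ ℕ λ q → q < m × T (bitAt S q) × T (R q p)

  Dominating⇔Dominated : ∀ {m} (G : Graph m) → (∀ u v → adj G u v ≡ R (toℕ u) (toℕ v)) →
                         ∀ S → Dominating G S ⇔ (∀ p → p < m → Dominated S p)
  Dominating⇔Dominated G adj≡R S = mk⇔ to from
    where
    to : Dominating G S → ∀ p → p < _ → Dominated S p
    to dom p p<m with dom (fromℕ< p<m)
    ... | inj₁ p∈S = inj₁ (subst (T ∘′ bitAt S) (Fin.toℕ-fromℕ< p<m) (Equivalence.to (∈ₛ⇔bitAt S _) p∈S))
    ... | inj₂ (u , u∈S , uv) = inj₂ (toℕ u , Fin.toℕ<n u , Equivalence.to (∈ₛ⇔bitAt S u) u∈S ,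
            subst T (trans (adj≡R u _) (cong (R (toℕ u)) (Fin.toℕ-fromℕ< p<m))) uv)
    from : (∀ p → p < _ → Dominated S p) → Dominating G S
    from dom v with dom (toℕ v) (Fin.toℕ<n v)
    ... | inj₁ bit = inj₁ (Equivalence.from (∈ₛ⇔bitAt S v) bit)
    ... | inj₂ (q , q<m , bit , qv) = inj₂ (fromℕ< q<m ,
            Equivalence.from (∈ₛ⇔bitAt S _) (subst (T ∘′ bitAt S) (sym (Fin.toℕ-fromℕ< q<m)) bit) ,
            subst T (sym (trans (adj≡R _ v) (cong (λ x → R x (toℕ v)) (Fin.toℕ-fromℕ< q<m)))) qv)

module _ {n} (G : Graph n) where

  private
    counted? : ∀ i (S : Subset n) → Dec (Dominating G S × ∣ S ∣ ≡ i)
    counted? i S = dominating? G S ×-dec (∣ S ∣ ≟ i)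

  length≤domCoeff : ∀ {i xs} → Unique xs → (∀ {S} → S ∈ xs → Dominating G S × ∣ S ∣ ≡ i) →
                    length xs ≤ domCoeff G i
  length≤domCoeff {i} u xs-ok = Unique-⊆⇒length≤ u λ {S} S∈xs →
    ∈.∈-filter⁺ (counted? i) (allSubsets-complete n S) (xs-ok S∈xs)

  domCoeff≤length : ∀ {i} zs → (∀ S → Dominating G S → ∣ S ∣ ≡ i → S ∈ zs) → domCoeff G i ≤ length zs
  domCoeff≤length {i} zs complete = Unique-⊆⇒length≤ (Unique.filter⁺ (counted? i) (Unique-allSubsets n)) λ S∈ →
    let dom , size = proj₂ (∈.∈-filter⁻ (counted? i) {xs = allSubsets n} S∈) in complete _ dom size

[q*n+r]/n≡q : ∀ q {r} n .{{_ : NonZero n}} → r < n → (q * n + r) / n ≡ q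
[q*n+r]/n≡q q {r} n r<n = begin
  (q * n + r) / n          ≡⟨ +-distrib-/ (q * n) r (subst (_< n) (sym (cong₂ _+_ (m*n%n≡0 q n) (m<n⇒m%n≡m r<n))) r<n) ⟩
  q * n / n + r / n        ≡⟨ cong₂ _+_ (m*n/n≡m q n) (m<n⇒m/n≡0 r<n) ⟩
  q + 0                    ≡⟨ +-identityʳ q ⟩
  q                        ∎
  where open ≡-Reasoning

[q*n+r]%n≡r : ∀ q {r} n .{{_ : NonZero n}} → r < n → (q * n + r) % n ≡ r
[q*n+r]%n≡r q {r} n r<n = trans (cong (_% n) (+-comm (q * n) r)) (trans ([m+kn]%n≡m%n r q n) (m<n⇒m%n≡m r<n))

[m/n]*n+m%n≡m : ∀ m n .{{_ : NonZero n}} → (m / n) * n + m % n ≡ m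
[m/n]*n+m%n≡m m n = trans (+-comm ((m / n) * n) (m % n)) (sym (m≡m%n+[m/n]*n m n))

0<3 : 0 < 3
0<3 = s≤s z≤n

1<3 : 1 < 3
1<3 = s≤s (s≤s z≤n)

2<3 : 2 < 3
2<3 = s≤s (s≤s (s≤s z≤n))

data Edge : TLabel → TLabel → Set where
  root-leg : ∀ i → Edge root (leg i)
  leg-x    : ∀ i j → Edge (leg i) (pathv i j 0)
  x-y      : ∀ i j → Edge (pathv i j 0) (pathv i j 1)
  y-z      : ∀ i j → Edge (pathv i j 1) (pathv i j 2)

edge⇒Edge : ∀ l l′ → T (edge l l′) → Edge l l′
edge⇒Edge root (leg i) _ = root-leg i
edge⇒Edge (leg i) (pathv i′ j zero) i≡i′ with ≡ᵇ⇒≡ i i′ i≡i′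
... | refl = leg-x i j
edge⇒Edge (pathv i j zero) (pathv i′ j′ (suc zero)) h with Equivalence.to T-∧ h
... | i≡i′ , j≡j′ with ≡ᵇ⇒≡ i i′ i≡i′ | ≡ᵇ⇒≡ j j′ j≡j′
...   | refl | refl = x-y i j
edge⇒Edge (pathv i j (suc zero)) (pathv i′ j′ (suc (suc zero))) h with Equivalence.to T-∧ h
... | i≡i′ , j≡j′ with ≡ᵇ⇒≡ i i′ i≡i′ | ≡ᵇ⇒≡ j j′ j≡j′
...   | refl | refl = y-z i j

Edge⇒edge : ∀ {l l′} → Edge l l′ → T (edge l l′)
Edge⇒edge (root-leg i) = _
Edge⇒edge (leg-x i j)  = ≡⇒≡ᵇ i i refl
Edge⇒edge (x-y i j)    = Equivalence.from T-∧ (≡⇒≡ᵇ i i refl , ≡⇒≡ᵇ j j refl)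
Edge⇒edge (y-z i j)    = Equivalence.from T-∧ (≡⇒≡ᵇ i i refl , ≡⇒≡ᵇ j j refl)

Adjacent : TLabel → TLabel → Set
Adjacent l l′ = Edge l l′ ⊎ Edge l′ l

tadj⇔Adjacent : ∀ q p → T (tadj q p) ⇔ Adjacent (decode q) (decode p)
tadj⇔Adjacent q p = mk⇔
  (λ h → Sum.map (edge⇒Edge _ _) (edge⇒Edge _ _) (Equivalence.to T-∨ h))
  (λ a → Equivalence.from T-∨ (Sum.map Edge⇒edge Edge⇒edge a))

adjacent-root : ∀ {l} → Adjacent l root → Σ ℕ λ i → l ≡ leg i
adjacent-root (inj₂ (root-leg i)) = i , refl

adjacent-leg : ∀ {l i} → Adjacent l (leg i) → l ≡ root ⊎ Σ ℕ λ j → l ≡ pathv i j 0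
adjacent-leg (inj₁ (root-leg i)) = inj₁ refl
adjacent-leg (inj₂ (leg-x i j))  = inj₂ (j , refl)

adjacent-x : ∀ {l i j} → Adjacent l (pathv i j 0) → l ≡ leg i ⊎ l ≡ pathv i j 1
adjacent-x (inj₁ (leg-x i j)) = inj₁ refl
adjacent-x (inj₂ (x-y i j))   = inj₂ refl

adjacent-y : ∀ {l i j} → Adjacent l (pathv i j 1) → l ≡ pathv i j 0 ⊎ l ≡ pathv i j 2
adjacent-y (inj₁ (x-y i j)) = inj₁ refl
adjacent-y (inj₂ (y-z i j)) = inj₂ refl

adjacent-z : ∀ {l i j} → Adjacent l (pathv i j 2) → l ≡ pathv i j 1
adjacent-z (inj₁ (y-z i j)) = refl

index : TLabel → ℕ
index root          = 0
index (leg i)       = suc i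
index (pathv i j t) = 4 + (j * 9 + (i * 3 + t))

index-decode : ∀ q → index (decode q) ≡ q
index-decode 0 = refl
index-decode 1 = refl
index-decode 2 = refl
index-decode 3 = refl
index-decode (suc (suc (suc (suc r)))) = cong (4 +_) (begin
  r / 9 * 9 + ((r % 9) / 3 * 3 + (r % 9) % 3)  ≡⟨ cong (r / 9 * 9 +_) ([m/n]*n+m%n≡m (r % 9) 3) ⟩
  r / 9 * 9 + r % 9                            ≡⟨ [m/n]*n+m%n≡m r 9 ⟩
  r                                            ∎)
  where open ≡-Reasoning

decode≡⇒≡index : ∀ {q l} → decode q ≡ l → q ≡ index l
decode≡⇒≡index {q} refl = sym (index-decode q)

decode-leg : ∀ {i} → i < 3 → decode (suc i) ≡ leg i
decode-leg {0} _ = refl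
decode-leg {1} _ = refl
decode-leg {2} _ = refl
decode-leg {suc (suc (suc _))} (s≤s (s≤s (s≤s ())))

decode-leg⁻¹ : ∀ {q i} → decode q ≡ leg i → i < 3
decode-leg⁻¹ {1} refl = 0<3
decode-leg⁻¹ {2} refl = 1<3
decode-leg⁻¹ {3} refl = 2<3

i*3+t<9 : ∀ {i t} → i < 3 → t < 3 → i * 3 + t < 9
i*3+t<9 {i} {t} i<3 t<3 = begin-strict
  i * 3 + t  <⟨ +-monoʳ-< (i * 3) t<3 ⟩
  i * 3 + 3  ≡⟨ +-comm (i * 3) 3 ⟩
  suc i * 3  ≤⟨ *-monoˡ-≤ 3 i<3 ⟩
  9          ∎
  where open ≤-Reasoning

decode-path : ∀ {i t} j → i < 3 → t < 3 → decode (index (pathv i j t)) ≡ pathv i j t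
decode-path {i} {t} j i<3 t<3 = trans
  (cong₂ (λ c j′ → pathv (c / 3) j′ (c % 3)) ([q*n+r]%n≡r j 9 c<9) ([q*n+r]/n≡q j 9 c<9))
  (cong₂ (λ i′ t′ → pathv i′ j t′) ([q*n+r]/n≡q i 3 t<3) ([q*n+r]%n≡r i 3 t<3))
  where
  c<9 : i * 3 + t < 9
  c<9 = i*3+t<9 i<3 t<3

data VertexView (k : ℕ) : ℕ → Set where
  root-vertex : VertexView k 0
  leg-vertex  : ∀ {i} → i < 3 → VertexView k (suc i)
  path-vertex : ∀ (j : Fin k) {i t} → i < 3 → t < 3 → VertexView k (index (pathv i (toℕ j) t))

vertexView : ∀ k {p} → p < 4 + k * 9 → VertexView k p
vertexView k {0} _ = root-vertex
vertexView k {1} _ = leg-vertex 0<3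
vertexView k {2} _ = leg-vertex 1<3
vertexView k {3} _ = leg-vertex 2<3
vertexView k {suc (suc (suc (suc r)))} (s≤s (s≤s (s≤s (s≤s r<k*9)))) =
  subst (VertexView k) index≡ (path-vertex (fromℕ< j<k) (m<n*o⇒m/o<n (m%n<n r 9)) (m%n<n (r % 9) 3))
  where
  j<k : r / 9 < k
  j<k = m<n*o⇒m/o<n r<k*9
  index≡ : index (pathv ((r % 9) / 3) (toℕ (fromℕ< j<k)) ((r % 9) % 3)) ≡ 4 + r
  index≡ = trans (cong (λ j → index (pathv ((r % 9) / 3) j ((r % 9) % 3))) (Fin.toℕ-fromℕ< j<k)) (index-decode (4 + r))

-- Subsets are handled as a ++ concat bs (embed below); in the numbering of decode, a holds v₀, …, v₃
-- and block j of bs holds x, y, z of the j-th path under v₁, then v₂, then v₃.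
legBit : Vec Bool 4 → ℕ → Bool
legBit a i = bitAt a (suc i)

pathBit : ℕ → ℕ → Vec Bool 9 → Bool
pathBit i t b = bitAt b (i * 3 + t)

pathDominated : Bool → Bool → Bool → Bool → Bool
pathDominated v x y z = (v ∨ x ∨ y) ∧ (x ∨ y ∨ z) ∧ (y ∨ z)

blockDominated : Vec Bool 4 → Vec Bool 9 → Bool
blockDominated (_ ∷ v₁ ∷ v₂ ∷ v₃ ∷ []) (x₁ ∷ y₁ ∷ z₁ ∷ x₂ ∷ y₂ ∷ z₂ ∷ x₃ ∷ y₃ ∷ z₃ ∷ []) =
  pathDominated v₁ x₁ y₁ z₁ ∧ pathDominated v₂ x₂ y₂ z₂ ∧ pathDominated v₃ x₃ y₃ z₃

PathDominated : Vec Bool 4 → Vec Bool 9 → ℕ → Set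
PathDominated a b i = T (pathDominated (legBit a i) (pathBit i 0 b) (pathBit i 1 b) (pathBit i 2 b))

T-pathDominated : ∀ v x y z → T (pathDominated v x y z) ⇔ ((T v ⊎ T x ⊎ T y) × (T x ⊎ T y ⊎ T z) × (T y ⊎ T z))
T-pathDominated v x y z = mk⇔
  (λ h → let vxy , xyz , yz = ∧⇒× h in ∨⇒⊎₃ vxy , ∨⇒⊎₃ xyz , Equivalence.to T-∨ yz)
  (λ (vxy , xyz , yz) → Equivalence.from T-∧ (⊎₃⇒∨ vxy , Equivalence.from T-∧ (⊎₃⇒∨ xyz , Equivalence.from T-∨ yz)))
  where
  ∧⇒× : ∀ {p q r} → T (p ∧ q ∧ r) → T p × T q × T r
  ∧⇒× h = let p , qr = Equivalence.to T-∧ h in p , Equivalence.to T-∧ qr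
  ∨⇒⊎₃ : ∀ {p q r} → T (p ∨ q ∨ r) → T p ⊎ T q ⊎ T r
  ∨⇒⊎₃ h = Sum.map₂ (Equivalence.to T-∨) (Equivalence.to T-∨ h)
  ⊎₃⇒∨ : ∀ {p q r} → T p ⊎ T q ⊎ T r → T (p ∨ q ∨ r)
  ⊎₃⇒∨ h = Equivalence.from T-∨ (Sum.map₂ (Equivalence.from T-∨) h)

blockDominated⇔ : ∀ a b → T (blockDominated a b) ⇔ (∀ {i} → i < 3 → PathDominated a b i)
blockDominated⇔ a@(_ ∷ v₁ ∷ v₂ ∷ v₃ ∷ []) b@(x₁ ∷ y₁ ∷ z₁ ∷ x₂ ∷ y₂ ∷ z₂ ∷ x₃ ∷ y₃ ∷ z₃ ∷ []) =
  mk⇔ to from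
  where
  P₁ P₂ P₃ : Bool
  P₁ = pathDominated v₁ x₁ y₁ z₁
  P₂ = pathDominated v₂ x₂ y₂ z₂
  P₃ = pathDominated v₃ x₃ y₃ z₃
  to : T (blockDominated a b) → ∀ {i} → i < 3 → PathDominated a b i
  to h {0} _ = proj₁ (Equivalence.to (T-∧ {P₁}) h)
  to h {1} _ = proj₁ (Equivalence.to (T-∧ {P₂}) (proj₂ (Equivalence.to (T-∧ {P₁}) h)))
  to h {2} _ = proj₂ (Equivalence.to (T-∧ {P₂}) (proj₂ (Equivalence.to (T-∧ {P₁}) h)))
  to h {suc (suc (suc _))} (s≤s (s≤s (s≤s ())))
  from : (∀ {i} → i < 3 → PathDominated a b i) → T (blockDominated a b)
  from h = Equivalence.from (T-∧ {P₁})
    (h 0<3 , Equivalence.from (T-∧ {P₂}) (h 1<3 , h 2<3))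

RootDominated : Vec Bool 4 → Set
RootDominated a = T (bitAt a 0) ⊎ Σ ℕ λ i → i < 3 × T (legBit a i)

LegDominated : ∀ {k} → Vec Bool 4 → Vec (Vec Bool 9) k → ℕ → Set
LegDominated a bs i = T (legBit a i) ⊎ T (bitAt a 0) ⊎ VAny (T ∘ pathBit i 0) bs

record LocallyDominated {k} (a : Vec Bool 4) (bs : Vec (Vec Bool 9) k) : Set where
  field
    root-dominated   : RootDominated a
    legs-dominated   : ∀ {i} → i < 3 → LegDominated a bs i
    blocks-dominated : VAll (T ∘ blockDominated a) bs

path-index<⇒j<k : ∀ {i j t k} → index (pathv i j t) < 4 + k * 9 → j < k
path-index<⇒j<k {i} {j} {t} {k} (s≤s (s≤s (s≤s (s≤s h)))) = *-cancelʳ-< 9 j k (≤-<-trans (m≤m+n (j * 9) (i * 3 + t)) h)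

module _ {k} (a : Vec Bool 4) (bs : Vec (Vec Bool 9) k) where

  private
    m : ℕ
    m = 4 + k * 9

    S : Vec Bool m
    S = a ++ concat bs

    Dom : ℕ → Set
    Dom = Dominated tadj S

    bitAt-root : bitAt S 0 ≡ bitAt a 0
    bitAt-root = bitAt-++ˡ a (concat bs) (s≤s z≤n)

    bitAt-leg : ∀ {i} → i < 3 → bitAt S (suc i) ≡ legBit a i
    bitAt-leg i<3 = bitAt-++ˡ a (concat bs) (s≤s i<3)

    bitAt-path : ∀ (j : Fin k) {i t} → i < 3 → t < 3 → bitAt S (index (pathv i (toℕ j) t)) ≡ pathBit i t (lookup bs j)
    bitAt-path j {i} {t} i<3 t<3 =
      trans (bitAt-++ʳ a (concat bs) (toℕ j * 9 + (i * 3 + t))) (bitAt-concat bs j (i*3+t<9 i<3 t<3))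

    leg<m : ∀ {i} → i < 3 → suc i < m
    leg<m i<3 = ≤-trans (s≤s i<3) (m≤m+n 4 (k * 9))

    path<m : ∀ (j : Fin k) {i t} → i < 3 → t < 3 → index (pathv i (toℕ j) t) < m
    path<m j {i} {t} i<3 t<3 = +-monoʳ-< 4 (begin-strict
      toℕ j * 9 + (i * 3 + t)  <⟨ +-monoʳ-< (toℕ j * 9) (i*3+t<9 i<3 t<3) ⟩
      toℕ j * 9 + 9            ≡⟨ +-comm (toℕ j * 9) 9 ⟩
      suc (toℕ j) * 9          ≤⟨ *-monoˡ-≤ 9 (Fin.toℕ<n j) ⟩
      k * 9                    ∎)
      where open ≤-Reasoning

    dominator : ∀ {p l} → decode p ≡ l → Dom p →
                T (bitAt S p) ⊎ Σ ℕ λ q → q < m × T (bitAt S q) × Adjacent (decode q) l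
    dominator refl (inj₁ b)                  = inj₁ b
    dominator refl (inj₂ (q , q<m , b , qp)) = inj₂ (q , q<m , b , Equivalence.to (tadj⇔Adjacent q _) qp)

    by-neighbour : ∀ {q p l′ l} → decode q ≡ l′ → decode p ≡ l → Adjacent l′ l → q < m → T (bitAt S q) → Dom p
    by-neighbour refl refl adj q<m b = inj₂ (_ , q<m , b , Equivalence.from (tadj⇔Adjacent _ _) adj)

    moved : ∀ {q l} → decode q ≡ l → T (bitAt S q) → T (bitAt S (index l))
    moved e = subst (T ∘ bitAt S) (decode≡⇒≡index e)

  root-dominated⇔ : Dom 0 ⇔ RootDominated a
  root-dominated⇔ = mk⇔ to from
    where
    to : Dom 0 → RootDominated a
    to d with dominator refl d
    ... | inj₁ b = inj₁ (subst T bitAt-root b)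
    ... | inj₂ (q , _ , b , adj) with adjacent-root adj
    ...   | i , e = inj₂ (i , decode-leg⁻¹ e , subst T (bitAt-leg (decode-leg⁻¹ e)) (moved e b))
    from : RootDominated a → Dom 0
    from (inj₁ b) = inj₁ (subst T (sym bitAt-root) b)
    from (inj₂ (i , i<3 , b)) =
      by-neighbour (decode-leg i<3) refl (inj₂ (root-leg i)) (leg<m i<3) (subst T (sym (bitAt-leg i<3)) b)

  leg-dominated⇔ : ∀ {i} → i < 3 → Dom (suc i) ⇔ LegDominated a bs i
  leg-dominated⇔ {i} i<3 = mk⇔ to from
    where
    to : Dom (suc i) → LegDominated a bs i
    to d with dominator (decode-leg i<3) d
    ... | inj₁ b = inj₁ (subst T (bitAt-leg i<3) b)
    ... | inj₂ (q , q<m , b , adj) with adjacent-leg adj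
    ...   | inj₁ e       = inj₂ (inj₁ (subst T bitAt-root (moved e b)))
    ...   | inj₂ (j , e) = inj₂ (inj₂ (lose (∈-lookup J bs) (subst T (bitAt-path J i<3 0<3) b′)))
      where
      j<k : j < k
      j<k = path-index<⇒j<k {i} {j} {0} (subst (_< m) (decode≡⇒≡index e) q<m)
      J : Fin k
      J = fromℕ< j<k
      b′ : T (bitAt S (index (pathv i (toℕ J) 0)))
      b′ = subst (λ j → T (bitAt S (index (pathv i j 0)))) (sym (Fin.toℕ-fromℕ< j<k)) (moved e b)
    from : LegDominated a bs i → Dom (suc i)
    from (inj₁ b)        = inj₁ (subst T (sym (bitAt-leg i<3)) b)
    from (inj₂ (inj₁ b)) = by-neighbour refl (decode-leg i<3) (inj₁ (root-leg i)) (s≤s z≤n) (subst T (sym bitAt-root) b)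
    from (inj₂ (inj₂ x)) =
      by-neighbour (decode-path (toℕ J) i<3 0<3) (decode-leg i<3) (inj₂ (leg-x i (toℕ J))) (path<m J i<3 0<3)
        (subst T (sym (bitAt-path J i<3 0<3)) (VAny.lookup-index x))
      where
      J : Fin k
      J = VAny.index x

  module _ (j : Fin k) {i} (i<3 : i < 3) where

    private
      b : Vec Bool 9
      b = lookup bs j
      P : ℕ → ℕ
      P t = index (pathv i (toℕ j) t)

      self : ∀ {t} → t < 3 → T (pathBit i t b) → Dom (P t)
      self t<3 x = inj₁ (subst T (sym (bitAt-path j i<3 t<3)) x)

      along : ∀ {t t′} → t < 3 → t′ < 3 → Adjacent (pathv i (toℕ j) t′) (pathv i (toℕ j) t) →
              T (pathBit i t′ b) → Dom (P t)
      along t<3 t′<3 adj x = by-neighbour (decode-path (toℕ j) i<3 t′<3) (decode-path (toℕ j) i<3 t<3) adj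
                                          (path<m j i<3 t′<3) (subst T (sym (bitAt-path j i<3 t′<3)) x)

      bit : ∀ {q t} → t < 3 → decode q ≡ pathv i (toℕ j) t → T (bitAt S q) → T (pathBit i t b)
      bit t<3 e x = subst T (bitAt-path j i<3 t<3) (moved e x)

    x-dominated⇔ : Dom (P 0) ⇔ (T (legBit a i) ⊎ T (pathBit i 0 b) ⊎ T (pathBit i 1 b))
    x-dominated⇔ = mk⇔ to from
      where
      to : Dom (P 0) → T (legBit a i) ⊎ T (pathBit i 0 b) ⊎ T (pathBit i 1 b)
      to d with dominator (decode-path (toℕ j) i<3 0<3) d
      ... | inj₁ x = inj₂ (inj₁ (subst T (bitAt-path j i<3 0<3) x))
      ... | inj₂ (q , _ , x , adj) with adjacent-x adj
      ...   | inj₁ e = inj₁ (subst T (bitAt-leg i<3) (moved e x))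
      ...   | inj₂ e = inj₂ (inj₂ (bit 1<3 e x))
      from : T (legBit a i) ⊎ T (pathBit i 0 b) ⊎ T (pathBit i 1 b) → Dom (P 0)
      from (inj₁ v) = by-neighbour (decode-leg i<3) (decode-path (toℕ j) i<3 0<3) (inj₁ (leg-x i (toℕ j)))
                                   (leg<m i<3) (subst T (sym (bitAt-leg i<3)) v)
      from (inj₂ (inj₁ x)) = self 0<3 x
      from (inj₂ (inj₂ y)) = along 0<3 1<3 (inj₂ (x-y i (toℕ j))) y

    y-dominated⇔ : Dom (P 1) ⇔ (T (pathBit i 0 b) ⊎ T (pathBit i 1 b) ⊎ T (pathBit i 2 b))
    y-dominated⇔ = mk⇔ to from
      where
      to : Dom (P 1) → T (pathBit i 0 b) ⊎ T (pathBit i 1 b) ⊎ T (pathBit i 2 b)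
      to d with dominator (decode-path (toℕ j) i<3 1<3) d
      ... | inj₁ y = inj₂ (inj₁ (subst T (bitAt-path j i<3 1<3) y))
      ... | inj₂ (q , _ , x , adj) with adjacent-y adj
      ...   | inj₁ e = inj₁ (bit 0<3 e x)
      ...   | inj₂ e = inj₂ (inj₂ (bit 2<3 e x))
      from : T (pathBit i 0 b) ⊎ T (pathBit i 1 b) ⊎ T (pathBit i 2 b) → Dom (P 1)
      from (inj₁ x)        = along 1<3 0<3 (inj₁ (x-y i (toℕ j))) x
      from (inj₂ (inj₁ y)) = self 1<3 y
      from (inj₂ (inj₂ z)) = along 1<3 2<3 (inj₂ (y-z i (toℕ j))) z

    z-dominated⇔ : Dom (P 2) ⇔ (T (pathBit i 1 b) ⊎ T (pathBit i 2 b))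
    z-dominated⇔ = mk⇔ to from
      where
      to : Dom (P 2) → T (pathBit i 1 b) ⊎ T (pathBit i 2 b)
      to d with dominator (decode-path (toℕ j) i<3 2<3) d
      ... | inj₁ z = inj₂ (subst T (bitAt-path j i<3 2<3) z)
      ... | inj₂ (q , _ , x , adj) = inj₁ (bit 1<3 (adjacent-z adj) x)
      from : T (pathBit i 1 b) ⊎ T (pathBit i 2 b) → Dom (P 2)
      from (inj₁ y) = along 2<3 1<3 (inj₁ (y-z i (toℕ j))) y
      from (inj₂ z) = self 2<3 z

    path-dominated⇔ : (Dom (P 0) × Dom (P 1) × Dom (P 2)) ⇔ PathDominated a b i
    path-dominated⇔ = mk⇔
      (λ (dx , dy , dz) → join (Equivalence.to x-dominated⇔ dx , Equivalence.to y-dominated⇔ dy , Equivalence.to z-dominated⇔ dz))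
      (λ pd → let vxy , xyz , yz = split pd in
        Equivalence.from x-dominated⇔ vxy , Equivalence.from y-dominated⇔ xyz , Equivalence.from z-dominated⇔ yz)
      where
      open Equivalence (T-pathDominated (legBit a i) (pathBit i 0 b) (pathBit i 1 b) (pathBit i 2 b))
        renaming (to to split; from to join)

  locallyDominated⇔ : (∀ p → p < m → Dom p) ⇔ LocallyDominated a bs
  locallyDominated⇔ = mk⇔ to from
    where
    open LocallyDominated
    to : (∀ p → p < m → Dom p) → LocallyDominated a bs
    to dom = record
      { root-dominated   = Equivalence.to root-dominated⇔ (dom 0 (s≤s z≤n))
      ; legs-dominated   = λ i<3 → Equivalence.to (leg-dominated⇔ i<3) (dom _ (leg<m i<3))
      ; blocks-dominated = VAll.lookup⁻ λ j → Equivalence.from (blockDominated⇔ a (lookup bs j)) λ i<3 →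
          Equivalence.to (path-dominated⇔ j i<3) (dom _ (path<m j i<3 0<3) , dom _ (path<m j i<3 1<3) , dom _ (path<m j i<3 2<3))
      }
    from : LocallyDominated a bs → ∀ p → p < m → Dom p
    from ld p p<m with vertexView k p<m
    ... | root-vertex    = Equivalence.from root-dominated⇔ (root-dominated ld)
    ... | leg-vertex i<3 = Equivalence.from (leg-dominated⇔ i<3) (legs-dominated ld i<3)
    ... | path-vertex j {i} {t} i<3 t<3 with Equivalence.from (path-dominated⇔ j i<3)
          (Equivalence.to (blockDominated⇔ a (lookup bs j)) (VAll.lookup⁺ (blocks-dominated ld) j) i<3)
    ...   | dx , dy , dz with t | t<3
    ...     | 0 | _ = dx
    ...     | 1 | _ = dy
    ...     | 2 | _ = dz
    ...     | suc (suc (suc _)) | s≤s (s≤s (s≤s ()))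

1≤⟦_⟧ : ∀ {b} → T b → 1 ≤ ⟦ b ⟧
1≤⟦_⟧ {true} _ = s≤s z≤n

Any⇒1≤sum : ∀ {A : Set} {k} (f : A → Bool) {bs : Vec A k} → VAny (T ∘ f) bs → 1 ≤ sum (map (⟦_⟧ ∘ f) bs)
Any⇒1≤sum f {b ∷ bs} (here fb)  = ≤-trans 1≤⟦ fb ⟧ (m≤m+n ⟦ f b ⟧ _)
Any⇒1≤sum f {b ∷ bs} (there fs) = ≤-trans (Any⇒1≤sum f fs) (m≤n+m _ ⟦ f b ⟧)

path-weight : ∀ x y z → T y ⊎ T z → suc ⟦ x ⟧ ≤ ⟦ x ⟧ + (⟦ y ⟧ + ⟦ z ⟧)
path-weight x y z y∨z = subst (_≤ ⟦ x ⟧ + (⟦ y ⟧ + ⟦ z ⟧)) (+-comm ⟦ x ⟧ 1) (+-monoʳ-≤ ⟦ x ⟧ (1≤⟦y⟧+⟦z⟧ y∨z))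
  where
  1≤⟦y⟧+⟦z⟧ : ∀ {y z} → T y ⊎ T z → 1 ≤ ⟦ y ⟧ + ⟦ z ⟧
  1≤⟦y⟧+⟦z⟧ {true}          _ = s≤s z≤n
  1≤⟦y⟧+⟦z⟧ {false} {true}  _ = s≤s z≤n
  1≤⟦y⟧+⟦z⟧ {false} {false} (inj₁ ())
  1≤⟦y⟧+⟦z⟧ {false} {false} (inj₂ ())

blockDominated⇒weight : ∀ a b → T (blockDominated a b) →
  3 + (⟦ pathBit 0 0 b ⟧ + (⟦ pathBit 1 0 b ⟧ + ⟦ pathBit 2 0 b ⟧)) ≤ weight b
blockDominated⇒weight a b@(x₁ ∷ y₁ ∷ z₁ ∷ x₂ ∷ y₂ ∷ z₂ ∷ x₃ ∷ y₃ ∷ z₃ ∷ []) h = begin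
  3 + (⟦ x₁ ⟧ + (⟦ x₂ ⟧ + ⟦ x₃ ⟧))
    ≡⟨ +-suc-distrib ⟦ x₁ ⟧ ⟦ x₂ ⟧ ⟦ x₃ ⟧ ⟩
  suc ⟦ x₁ ⟧ + (suc ⟦ x₂ ⟧ + suc ⟦ x₃ ⟧)
    ≤⟨ +-mono-≤ (path-weight x₁ y₁ z₁ (y∨z 0<3))
                (+-mono-≤ (path-weight x₂ y₂ z₂ (y∨z 1<3)) (path-weight x₃ y₃ z₃ (y∨z 2<3))) ⟩
  (⟦ x₁ ⟧ + (⟦ y₁ ⟧ + ⟦ z₁ ⟧)) + ((⟦ x₂ ⟧ + (⟦ y₂ ⟧ + ⟦ z₂ ⟧)) + (⟦ x₃ ⟧ + (⟦ y₃ ⟧ + ⟦ z₃ ⟧)))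
    ≡⟨ regroup ⟦ x₁ ⟧ ⟦ y₁ ⟧ ⟦ z₁ ⟧ ⟦ x₂ ⟧ ⟦ y₂ ⟧ ⟦ z₂ ⟧ ⟦ x₃ ⟧ ⟦ y₃ ⟧ ⟦ z₃ ⟧ ⟩
  weight b  ∎
  where
  open ≤-Reasoning
  y∨z : ∀ {i} → i < 3 → T (pathBit i 1 b) ⊎ T (pathBit i 2 b)
  y∨z {i} i<3 = proj₂ (proj₂ (Equivalence.to (T-pathDominated (legBit a i) (pathBit i 0 b) (pathBit i 1 b) (pathBit i 2 b))
                  (Equivalence.to (blockDominated⇔ a b) h i<3)))
  +-suc-distrib : ∀ x₁ x₂ x₃ → 3 + (x₁ + (x₂ + x₃)) ≡ suc x₁ + (suc x₂ + suc x₃)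
  +-suc-distrib = solve-∀
  regroup : ∀ x₁ y₁ z₁ x₂ y₂ z₂ x₃ y₃ z₃ →
    (x₁ + (y₁ + z₁)) + ((x₂ + (y₂ + z₂)) + (x₃ + (y₃ + z₃))) ≡
    x₁ + (y₁ + (z₁ + (x₂ + (y₂ + (z₂ + (x₃ + (y₃ + (z₃ + 0))))))))
  regroup = solve-∀

blockDominated⇒3≤weight : ∀ a b → T (blockDominated a b) → 3 ≤ weight b
blockDominated⇒3≤weight a b h = ≤-trans (m≤m+n 3 _) (blockDominated⇒weight a b h)

xCount : ∀ {k} → ℕ → Vec (Vec Bool 9) k → ℕ
xCount i bs = sum (map (⟦_⟧ ∘ pathBit i 0) bs)

blocks-weight : ∀ {k} a (bs : Vec (Vec Bool 9) k) → VAll (T ∘ blockDominated a) bs →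
  k * 3 + (xCount 0 bs + (xCount 1 bs + xCount 2 bs)) ≤ sum (map weight bs)
blocks-weight a []       []       = z≤n
blocks-weight {suc k} a (b ∷ bs) (h ∷ hs) = begin
  suc k * 3 + ((x₀ + X₀) + ((x₁ + X₁) + (x₂ + X₂)))
    ≡⟨ regroup k x₀ x₁ x₂ X₀ X₁ X₂ ⟩
  (3 + (x₀ + (x₁ + x₂))) + (k * 3 + (X₀ + (X₁ + X₂)))
    ≤⟨ +-mono-≤ (blockDominated⇒weight a b h) (blocks-weight a bs hs) ⟩
  weight b + sum (map weight bs)  ∎
  where
  open ≤-Reasoning
  x₀ x₁ x₂ X₀ X₁ X₂ : ℕ
  x₀ = ⟦ pathBit 0 0 b ⟧
  x₁ = ⟦ pathBit 1 0 b ⟧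
  x₂ = ⟦ pathBit 2 0 b ⟧
  X₀ = xCount 0 bs
  X₁ = xCount 1 bs
  X₂ = xCount 2 bs
  regroup : ∀ k x₀ x₁ x₂ X₀ X₁ X₂ →
    suc k * 3 + ((x₀ + X₀) + ((x₁ + X₁) + (x₂ + X₂))) ≡ (3 + (x₀ + (x₁ + x₂))) + (k * 3 + (X₀ + (X₁ + X₂)))
  regroup = solve-∀

-- Without v₀ every leg vᵢ needs vᵢ itself or some xᵢⱼ, and every path already needs yᵢⱼ or zᵢⱼ.
rootless-weight : ∀ {k v₁ v₂ v₃} {bs : Vec (Vec Bool 9) k} → LocallyDominated (false ∷ v₁ ∷ v₂ ∷ v₃ ∷ []) bs →
                  3 + k * 3 ≤ weight ((false ∷ v₁ ∷ v₂ ∷ v₃ ∷ []) ++ concat bs)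
rootless-weight {k} {v₁} {v₂} {v₃} {bs} ld = begin
  3 + k * 3
    ≤⟨ +-monoˡ-≤ (k * 3) (+-mono-≤ (leg-count 0<3) (+-mono-≤ (leg-count 1<3) (leg-count 2<3))) ⟩
  ((⟦ v₁ ⟧ + X₀) + ((⟦ v₂ ⟧ + X₁) + (⟦ v₃ ⟧ + X₂))) + k * 3
    ≡⟨ regroup ⟦ v₁ ⟧ ⟦ v₂ ⟧ ⟦ v₃ ⟧ X₀ X₁ X₂ (k * 3) ⟩
  ⟦ v₁ ⟧ + (⟦ v₂ ⟧ + (⟦ v₃ ⟧ + (k * 3 + (X₀ + (X₁ + X₂)))))
    ≤⟨ +-monoʳ-≤ ⟦ v₁ ⟧ (+-monoʳ-≤ ⟦ v₂ ⟧ (+-monoʳ-≤ ⟦ v₃ ⟧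
         (blocks-weight (false ∷ v₁ ∷ v₂ ∷ v₃ ∷ []) bs (blocks-dominated ld)))) ⟩
  ⟦ v₁ ⟧ + (⟦ v₂ ⟧ + (⟦ v₃ ⟧ + sum (map weight bs)))
    ≡⟨ cong (λ w → ⟦ v₁ ⟧ + (⟦ v₂ ⟧ + (⟦ v₃ ⟧ + w))) (sym (weight-concat bs)) ⟩
  ⟦ v₁ ⟧ + (⟦ v₂ ⟧ + (⟦ v₃ ⟧ + weight (concat bs)))  ∎
  where
  open ≤-Reasoning
  open LocallyDominated
  X₀ X₁ X₂ : ℕ
  X₀ = xCount 0 bs
  X₁ = xCount 1 bs
  X₂ = xCount 2 bs
  leg-count : ∀ {i} → i < 3 → 1 ≤ ⟦ legBit (false ∷ v₁ ∷ v₂ ∷ v₃ ∷ []) i ⟧ + xCount i bs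
  leg-count {i} i<3 with legs-dominated ld i<3
  ... | inj₁ v         = ≤-trans 1≤⟦ v ⟧ (m≤m+n _ _)
  ... | inj₂ (inj₂ xs) = ≤-trans (Any⇒1≤sum (pathBit i 0) xs) (m≤n+m _ _)
  regroup : ∀ v₁ v₂ v₃ X₀ X₁ X₂ K →
    ((v₁ + X₀) + ((v₂ + X₁) + (v₃ + X₂))) + K ≡ v₁ + (v₂ + (v₃ + (K + (X₀ + (X₁ + X₂)))))
  regroup = solve-∀

concat-injective : ∀ {A : Set} {n k} (xss yss : Vec (Vec A n) k) → concat xss ≡ concat yss → xss ≡ yss
concat-injective []         []         _ = refl
concat-injective (xs ∷ xss) (ys ∷ yss) e =
  cong₂ _∷_ (Vec.++-injectiveˡ xs ys e) (concat-injective xss yss (Vec.++-injectiveʳ xs ys e))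

module _ {k : ℕ} where

  embed : Vec Bool 4 → Vec (Vec Bool 9) k → Subset (4 + k * 9)
  embed a bs = a ++ concat bs

  embeds : Vec Bool 4 → List (Vec (Vec Bool 9) k) → List (Subset (4 + k * 9))
  embeds a = mapₗ (embed a)

  embed-surjective : ∀ (S : Subset (4 + k * 9)) → Σ[ a ∈ Vec Bool 4 ] Σ[ bs ∈ Vec (Vec Bool 9) k ] S ≡ embed a bs
  embed-surjective S with splitAt 4 S
  ... | a , r , S≡a++r with group k 9 r
  ...   | bs , r≡concat = a , bs , trans S≡a++r (cong (a ++_) r≡concat)

  weight-embed : ∀ a (bs : Vec (Vec Bool 9) k) → weight (embed a bs) ≡ weight a + sum (map weight bs)
  weight-embed a bs = trans (weight-++ a (concat bs)) (cong (weight a +_) (weight-concat bs))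

  Unique-embeds : ∀ a {xs} → Unique xs → Unique (embeds a xs)
  Unique-embeds a = Unique.map⁺ λ {bs} {bs′} e → concat-injective bs bs′ (Vec.++-injectiveʳ a a e)

  embeds-disjoint : ∀ {a a′ xs ys} → a ≢ a′ → Disjoint (embeds a xs) (embeds a′ ys)
  embeds-disjoint {a} {a′} a≢a′ (p , q) with ∈.∈-map⁻ (embed a) p | ∈.∈-map⁻ (embed a′) q
  ... | bs , _ , refl | bs′ , _ , e = a≢a′ (Vec.++-injectiveˡ a a′ e)

  ∈-embeds⁻ : ∀ {a xs S} → S ∈ embeds a xs → Σ[ bs ∈ Vec (Vec Bool 9) k ] bs ∈ xs × S ≡ embed a bs
  ∈-embeds⁻ {a} = ∈.∈-map⁻ (embed a)

dominatedBlock? : ∀ a w (b : Vec Bool 9) → Dec (T (blockDominated a b) × weight b ≡ w)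
dominatedBlock? a w b = T? (blockDominated a b) ×-dec (weight b ≟ w)

dominatedBlockWithX? : ∀ a i w (b : Vec Bool 9) → Dec ((T (blockDominated a b) × weight b ≡ w) × T (pathBit i 0 b))
dominatedBlockWithX? a i w b = dominatedBlock? a w b ×-dec T? (pathBit i 0 b)

dominatedBlocks : Vec Bool 4 → ℕ → List (Vec Bool 9)
dominatedBlocks a w = filter (dominatedBlock? a w) (allSubsets 9)

dominatedBlocksWithX : Vec Bool 4 → ℕ → ℕ → List (Vec Bool 9)
dominatedBlocksWithX a i w = filter (dominatedBlockWithX? a i w) (allSubsets 9)

∈-dominatedBlocks⁺ : ∀ {a w b} → T (blockDominated a b) → weight b ≡ w → b ∈ dominatedBlocks a w
∈-dominatedBlocks⁺ {a} {w} {b} h e = ∈.∈-filter⁺ (dominatedBlock? a w) (allSubsets-complete 9 b) (h , e)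

∈-dominatedBlocks⁻ : ∀ {a w b} → b ∈ dominatedBlocks a w → T (blockDominated a b) × weight b ≡ w
∈-dominatedBlocks⁻ {a} {w} p = proj₂ (∈.∈-filter⁻ (dominatedBlock? a w) p)

∈-dominatedBlocksWithX⁻ : ∀ {a i w b} → b ∈ dominatedBlocksWithX a i w →
                          (T (blockDominated a b) × weight b ≡ w) × T (pathBit i 0 b)
∈-dominatedBlocksWithX⁻ {a} {i} {w} p = proj₂ (∈.∈-filter⁻ (dominatedBlockWithX? a i w) p)

Unique-dominatedBlocks : ∀ a w → Unique (dominatedBlocks a w)
Unique-dominatedBlocks a w = Unique.filter⁺ (dominatedBlock? a w) (Unique-allSubsets 9)

Unique-dominatedBlocksWithX : ∀ a i w → Unique (dominatedBlocksWithX a i w)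
Unique-dominatedBlocksWithX a i w = Unique.filter⁺ (dominatedBlockWithX? a i w) (Unique-allSubsets 9)

rootOnly allLegs : Vec Bool 4
rootOnly = true ∷ false ∷ false ∷ false ∷ []
allLegs  = false ∷ true ∷ true ∷ true ∷ []

rootAndLeg legsExcept : ℕ → Vec Bool 4
rootAndLeg i = true  ∷ (i ≡ᵇ 0) ∷ (i ≡ᵇ 1) ∷ (i ≡ᵇ 2) ∷ []
legsExcept i = false ∷ not (i ≡ᵇ 0) ∷ not (i ≡ᵇ 1) ∷ not (i ≡ᵇ 2) ∷ []

legsExcept-legBit : ∀ i₀ {i} → i < 3 → T (legBit (legsExcept i₀) i) ⊎ i ≡ i₀
legsExcept-legBit i₀ {0} _ with i₀ ≡ᵇ 0 in eq
... | true  = inj₂ (sym (≡ᵇ⇒≡ i₀ 0 (subst T (sym eq) _)))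
... | false = inj₁ _
legsExcept-legBit i₀ {1} _ with i₀ ≡ᵇ 1 in eq
... | true  = inj₂ (sym (≡ᵇ⇒≡ i₀ 1 (subst T (sym eq) _)))
... | false = inj₁ _
legsExcept-legBit i₀ {2} _ with i₀ ≡ᵇ 2 in eq
... | true  = inj₂ (sym (≡ᵇ⇒≡ i₀ 2 (subst T (sym eq) _)))
... | false = inj₁ _
legsExcept-legBit i₀ {suc (suc (suc _))} (s≤s (s≤s (s≤s ())))

weight-legsExcept : ∀ {i₀} → i₀ < 3 → weight (legsExcept i₀) ≡ 2
weight-legsExcept {0} _ = refl
weight-legsExcept {1} _ = refl
weight-legsExcept {2} _ = refl
weight-legsExcept {suc (suc (suc _))} (s≤s (s≤s (s≤s ())))

allLegs-legBit : ∀ {i} → i < 3 → T (legBit allLegs i)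
allLegs-legBit {0} _ = _
allLegs-legBit {1} _ = _
allLegs-legBit {2} _ = _
allLegs-legBit {suc (suc (suc _))} (s≤s (s≤s (s≤s ())))

-- Leg i₀ is not chosen, so some x on it must be: exactly one block has weight 4 and contains it.
exceptionalFamily : ∀ k → ℕ → List (Vec (Vec Bool 9) k)
exceptionalFamily k i₀ =
  tuplesWithOne (dominatedBlocks (legsExcept i₀) 3) (dominatedBlocksWithX (legsExcept i₀) i₀ 4) k

size3k+3Families : ∀ k → List (List (Subset (4 + k * 9)))
size3k+3Families k =
  embeds allLegs (tuples (dominatedBlocks allLegs 3) k) ∷
  embeds (legsExcept 0) (exceptionalFamily k 0) ∷
  embeds (legsExcept 1) (exceptionalFamily k 1) ∷
  embeds (legsExcept 2) (exceptionalFamily k 2) ∷ []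

-- With v₀ chosen, weight 3k + 2 leaves room for either one block of weight 4 or one chosen leg.
size3k+2Candidates : ∀ k → List (List (Subset (4 + k * 9)))
size3k+2Candidates k =
  embeds rootOnly (tuplesWithOne (dominatedBlocks rootOnly 3) (dominatedBlocks rootOnly 4) k) ∷
  embeds (rootAndLeg 0) (tuples (dominatedBlocks (rootAndLeg 0) 3) k) ∷
  embeds (rootAndLeg 1) (tuples (dominatedBlocks (rootAndLeg 1) 3) k) ∷
  embeds (rootAndLeg 2) (tuples (dominatedBlocks (rootAndLeg 2) 3) k) ∷ []

private
  too-heavy : ∀ {k w} → 3 + k * 3 ≤ w → w ≡ 2 + k * 3 → ⊥
  too-heavy {k} 3+k*3≤w refl = 1+n≰n 3+k*3≤w

  blocks-total : ∀ {k} a (bs : Vec (Vec Bool 9) k) {x} → weight (embed a bs) ≡ weight a + x → sum (map weight bs) ≡ x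
  blocks-total a bs e = +-cancelˡ-≡ (weight a) _ _ (trans (sym (weight-embed a bs)) e)

  heavy-root : ∀ {k} a (bs : Vec (Vec Bool 9) k) → 3 ≤ weight a → LocallyDominated a bs → 3 + k * 3 ≤ weight (embed a bs)
  heavy-root {k} a bs 3≤wa ld = subst (3 + k * 3 ≤_) (sym (weight-embed a bs))
    (+-mono-≤ 3≤wa (sum-map-≥ weight (VAll.map (blockDominated⇒3≤weight a _) (LocallyDominated.blocks-dominated ld))))

  tuples-complete : ∀ {k} a (bs : Vec (Vec Bool 9) k) → LocallyDominated a bs →
                    sum (map weight bs) ≡ k * 3 → bs ∈ tuples (dominatedBlocks a 3) k
  tuples-complete a bs ld = ∈-tuples⁺-tight weight {P = T ∘ blockDominated a} (blockDominated⇒3≤weight a _)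
    (∈-dominatedBlocks⁺ {a} {3}) (LocallyDominated.blocks-dominated ld)

  tuplesWithOne-complete : ∀ {k} a (bs : Vec (Vec Bool 9) k) → LocallyDominated a bs →
                           sum (map weight bs) ≡ suc (k * 3) → bs ∈ tuplesWithOne (dominatedBlocks a 3) (dominatedBlocks a 4) k
  tuplesWithOne-complete a bs ld = ∈-tuplesWithOne⁺ weight {P = T ∘ blockDominated a} (blockDominated⇒3≤weight a _)
    (∈-dominatedBlocks⁺ {a} {3}) (∈-dominatedBlocks⁺ {a} {4}) (LocallyDominated.blocks-dominated ld)

  in-family : ∀ {k a xs} {bs : Vec (Vec Bool 9) k} →
              embeds a xs ∈ size3k+2Candidates k → bs ∈ xs → embed a bs ∈ concatₗ (size3k+2Candidates k)
  in-family {a = a} F∈ bs∈ = ∈.∈-concat⁺′ (∈.∈-map⁺ (embed a) bs∈) F∈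

size3k+2Candidates-complete : ∀ {k} a (bs : Vec (Vec Bool 9) k) → LocallyDominated a bs → weight (embed a bs) ≡ 2 + k * 3 →
                    embed a bs ∈ concatₗ (size3k+2Candidates k)
size3k+2Candidates-complete {k} (false ∷ _ ∷ _ ∷ _ ∷ []) bs ld w = ⊥-elim (too-heavy {k} (rootless-weight ld) w)
size3k+2Candidates-complete a@(true ∷ false ∷ false ∷ false ∷ []) bs ld w =
  in-family (here refl) (tuplesWithOne-complete a bs ld (blocks-total a bs w))
size3k+2Candidates-complete a@(true ∷ true ∷ false ∷ false ∷ []) bs ld w =
  in-family (there (here refl)) (tuples-complete a bs ld (blocks-total a bs w))
size3k+2Candidates-complete a@(true ∷ false ∷ true ∷ false ∷ []) bs ld w =
  in-family (there (there (here refl))) (tuples-complete a bs ld (blocks-total a bs w))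
size3k+2Candidates-complete a@(true ∷ false ∷ false ∷ true ∷ []) bs ld w =
  in-family (there (there (there (here refl)))) (tuples-complete a bs ld (blocks-total a bs w))
size3k+2Candidates-complete {k} a@(true ∷ true ∷ true ∷ _ ∷ []) bs ld w =
  ⊥-elim (too-heavy {k} (heavy-root a bs (s≤s (s≤s (s≤s z≤n))) ld) w)
size3k+2Candidates-complete {k} a@(true ∷ true ∷ false ∷ true ∷ []) bs ld w =
  ⊥-elim (too-heavy {k} (heavy-root a bs (s≤s (s≤s (s≤s z≤n))) ld) w)
size3k+2Candidates-complete {k} a@(true ∷ false ∷ true ∷ true ∷ []) bs ld w =
  ⊥-elim (too-heavy {k} (heavy-root a bs (s≤s (s≤s (s≤s z≤n))) ld) w)

module Counting {k} (G : Graph (4 + k * 9)) (adj≡tadj : ∀ u v → adj G u v ≡ tadj (toℕ u) (toℕ v)) where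

  Dominating⇔LocallyDominated : ∀ a (bs : Vec (Vec Bool 9) k) → Dominating G (embed a bs) ⇔ LocallyDominated a bs
  Dominating⇔LocallyDominated a bs = ⇔.trans (Dominating⇔Dominated tadj G adj≡tadj (embed a bs)) (locallyDominated⇔ a bs)

  embed-counted : ∀ {a} {bs : Vec (Vec Bool 9) k} {i} → LocallyDominated a bs → weight (embed a bs) ≡ i →
                  Dominating G (embed a bs) × ∣ embed a bs ∣ ≡ i
  embed-counted {a} {bs} ld w≡i = Equivalence.from (Dominating⇔LocallyDominated a bs) ld , trans (∣∣≡weight (embed a bs)) w≡i

  tuples-counted : ∀ {a w S} → RootDominated a → (∀ {i} → i < 3 → T (legBit a i) ⊎ T (bitAt a 0)) →
                   S ∈ embeds a (tuples (dominatedBlocks a w) k) → Dominating G S × ∣ S ∣ ≡ weight a + k * w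
  tuples-counted {a} {w} root-dom legs-dom S∈ with ∈-embeds⁻ S∈
  ... | bs , bs∈ , refl = embed-counted ld (trans (weight-embed a bs) (cong (weight a +_) (sum-map-const weight (VAll.map proj₂ blocks))))
    where
    blocks : VAll (λ b → T (blockDominated a b) × weight b ≡ w) bs
    blocks = VAll.map (∈-dominatedBlocks⁻ {a} {w}) (∈-tuples⁻ k bs∈)
    ld : LocallyDominated a bs
    ld = record
      { root-dominated   = root-dom
      ; legs-dominated   = λ i<3 → Sum.map₂ inj₁ (legs-dom i<3)
      ; blocks-dominated = VAll.map proj₁ blocks
      }

  exceptional-counted : ∀ {i₀ S} → i₀ < 3 → S ∈ embeds (legsExcept i₀) (exceptionalFamily k i₀) →
                        Dominating G S × ∣ S ∣ ≡ 3 + k * 3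
  exceptional-counted {i₀} i₀<3 S∈ with ∈-embeds⁻ S∈
  ... | bs , bs∈ , refl = embed-counted ld weight≡
    where
    a : Vec Bool 4
    a = legsExcept i₀
    members : VAll (λ b → b ∈ dominatedBlocks a 3 ⊎ b ∈ dominatedBlocksWithX a i₀ 4) bs ×
              VAny (_∈ dominatedBlocksWithX a i₀ 4) bs
    members = ∈-tuplesWithOne⁻ k bs∈
    x-on-leg : VAny (T ∘ pathBit i₀ 0) bs
    x-on-leg = VAny.map (proj₂ ∘ ∈-dominatedBlocksWithX⁻ {a} {i₀} {4}) (proj₂ members)
    root-dom : RootDominated a
    root-dom with legsExcept-legBit i₀ 0<3 | legsExcept-legBit i₀ 1<3
    ... | inj₁ v    | _      = inj₂ (0 , 0<3 , v)
    ... | inj₂ _    | inj₁ v = inj₂ (1 , 1<3 , v)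
    ... | inj₂ refl | inj₂ ()
    legs-dom : ∀ {i} → i < 3 → LegDominated a bs i
    legs-dom i<3 with legsExcept-legBit i₀ i<3
    ... | inj₁ v    = inj₁ v
    ... | inj₂ refl = inj₂ (inj₂ x-on-leg)
    ld : LocallyDominated a bs
    ld = record
      { root-dominated   = root-dom
      ; legs-dominated   = legs-dom
      ; blocks-dominated = VAll.map Sum.[ proj₁ ∘ ∈-dominatedBlocks⁻ {a} {3} , proj₁ ∘ proj₁ ∘ ∈-dominatedBlocksWithX⁻ {a} {i₀} {4} ]
                                    (proj₁ members)
      }
    weight≡ : weight (embed a bs) ≡ 3 + k * 3
    weight≡ = trans (weight-embed a bs) (cong₂ _+_ (weight-legsExcept i₀<3)
      (sum-map-tuplesWithOne weight (proj₂ ∘ ∈-dominatedBlocks⁻ {a} {3}) (proj₂ ∘ proj₁ ∘ ∈-dominatedBlocksWithX⁻ {a} {i₀} {4}) k bs∈))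

  1≤domCoeff[3k+1] : 1 ≤ domCoeff G (suc (k * 3))
  1≤domCoeff[3k+1] = subst (_≤ domCoeff G (suc (k * 3))) length≡1
    (length≤domCoeff G (Unique-embeds rootOnly (Unique-tuples k (Unique-dominatedBlocks rootOnly 3)))
      (tuples-counted (inj₁ _) λ _ → inj₂ _))
    where
    length≡1 : length (embeds rootOnly (tuples (dominatedBlocks rootOnly 3) k)) ≡ 1
    length≡1 = trans (List.length-map (embed rootOnly) (tuples (dominatedBlocks rootOnly 3) k))
                     (trans (length-tuples (dominatedBlocks rootOnly 3) k) (^-zeroˡ k))

  length-size3k+3Families≤domCoeff : length (concatₗ (size3k+3Families k)) ≤ domCoeff G (3 + k * 3)
  length-size3k+3Families≤domCoeff = length≤domCoeff G (Unique.concat⁺ uniques disjoint) counted-member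
    where
    weights-differ : ∀ a i → Disjoint (dominatedBlocks a 3) (dominatedBlocksWithX a i 4)
    weights-differ a i (p , q)
      with trans (sym (proj₂ (∈-dominatedBlocks⁻ {a} {3} p))) (proj₂ (proj₁ (∈-dominatedBlocksWithX⁻ {a} {i} {4} q)))
    ... | ()
    exceptional-unique : ∀ i → Unique (embeds (legsExcept i) (exceptionalFamily k i))
    exceptional-unique i = Unique-embeds (legsExcept i) (Unique-tuplesWithOne k (Unique-dominatedBlocks (legsExcept i) 3)
      (Unique-dominatedBlocksWithX (legsExcept i) i 4) (weights-differ (legsExcept i) i))
    uniques : All Unique (size3k+3Families k)
    uniques = Unique-embeds allLegs (Unique-tuples k (Unique-dominatedBlocks allLegs 3))
            ∷ exceptional-unique 0 ∷ exceptional-unique 1 ∷ exceptional-unique 2 ∷ []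
    disjoint : AllPairs Disjoint (size3k+3Families k)
    disjoint = (embeds-disjoint (λ ()) ∷ embeds-disjoint (λ ()) ∷ embeds-disjoint (λ ()) ∷ [])
             ∷ (embeds-disjoint (λ ()) ∷ embeds-disjoint (λ ()) ∷ [])
             ∷ (embeds-disjoint (λ ()) ∷ [])
             ∷ [] ∷ []
    counted-member : ∀ {S} → S ∈ concatₗ (size3k+3Families k) → Dominating G S × ∣ S ∣ ≡ 3 + k * 3
    counted-member S∈ with ∈.∈-concat⁻ (size3k+3Families k) S∈
    ... | here p                         = tuples-counted (inj₂ (0 , 0<3 , _)) (inj₁ ∘ allLegs-legBit) p
    ... | there (here p)                 = exceptional-counted 0<3 p
    ... | there (there (here p))         = exceptional-counted 1<3 p
    ... | there (there (there (here p))) = exceptional-counted 2<3 p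

  domCoeff≤length-size3k+2Candidates : domCoeff G (2 + k * 3) ≤ length (concatₗ (size3k+2Candidates k))
  domCoeff≤length-size3k+2Candidates = domCoeff≤length G (concatₗ (size3k+2Candidates k)) member
    where
    member : ∀ S → Dominating G S → ∣ S ∣ ≡ 2 + k * 3 → S ∈ concatₗ (size3k+2Candidates k)
    member S dom size with embed-surjective {k} S
    ... | a , bs , refl = size3k+2Candidates-complete a bs (Equivalence.to (Dominating⇔LocallyDominated a bs) dom)
                                           (trans (sym (∣∣≡weight (embed a bs))) size)

[m*n]^k≡m^k*n^k : ∀ m n k → (m * n) ^ k ≡ m ^ k * n ^ k
[m*n]^k≡m^k*n^k m n zero    = refl
[m*n]^k≡m^k*n^k m n (suc k) = trans (cong ((m * n) *_) ([m*n]^k≡m^k*n^k m n k)) (interchange m n (m ^ k) (n ^ k))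
  where
  interchange : ∀ m n x y → m * n * (x * y) ≡ m * x * (n * y)
  interchange = solve-∀

3[4+r]≤2^[4+r] : ∀ r → 3 * (4 + r) ≤ 2 ^ (4 + r)
3[4+r]≤2^[4+r] zero    = m≤m+n 12 4
3[4+r]≤2^[4+r] (suc r) = begin
  3 * (5 + r)                ≡⟨ *-suc 3 (4 + r) ⟩
  3 + 3 * (4 + r)            ≤⟨ +-mono-≤ (≤-trans (m≤m+n 3 _) IH) IH ⟩
  2 ^ (4 + r) + 2 ^ (4 + r)  ≡⟨ cong (2 ^ (4 + r) +_) (sym (+-identityʳ (2 ^ (4 + r)))) ⟩
  2 ^ (5 + r)                ∎
  where
  open ≤-Reasoning
  IH : 3 * (4 + r) ≤ 2 ^ (4 + r)
  IH = 3[4+r]≤2^[4+r] r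

log-concavity-fails : ∀ {a b c U L} → 1 ≤ a → b ≤ U → L ≤ c → U * U < L → ¬ (a * c ≤ b * b)
log-concavity-fails {a} {b} {c} {U} {L} 1≤a b≤U L≤c U²<L ac≤b² = <-irrefl refl (begin-strict
  L      ≤⟨ L≤c ⟩
  c      ≡⟨ *-identityˡ c ⟨
  1 * c  ≤⟨ *-monoˡ-≤ c 1≤a ⟩
  a * c  ≤⟨ ac≤b² ⟩
  b * b  ≤⟨ *-mono-≤ b≤U b≤U ⟩
  U * U  <⟨ U²<L ⟩
  L      ∎)
  where open ≤-Reasoning

size3k+2Bound²<size3k+3Bound : ∀ r → ((4 + r) * 9 + 3 * 2 ^ (4 + r)) * ((4 + r) * 9 + 3 * 2 ^ (4 + r)) <
                           8 ^ (4 + r) + 3 * ((4 + r) * (8 * 4 ^ (3 + r)))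
size3k+2Bound²<size3k+3Bound r = begin-strict
  U * U                                        ≤⟨ *-mono-≤ U≤12p U≤12p ⟩
  (12 * p) * (12 * p)                          ≡⟨ arith₁ p ⟩
  144 * (p * p)                                <⟨ m<m+n (144 * (p * p)) 0<16p² ⟩
  144 * (p * p) + 16 * (p * p)                 ≡⟨ arith₂ (p * p) ⟩
  8 * (8 * (p * p)) + 3 * (4 * (8 * (p * p)))  ≤⟨ +-mono-≤ (*-monoʳ-≤ 8 (*-monoˡ-≤ (p * p) 8≤p))
                                                            (*-monoʳ-≤ 3 (*-monoˡ-≤ (8 * (p * p)) (m≤m+n 4 r))) ⟩
  8 * (p * (p * p)) + 3 * (K * (8 * (p * p)))  ≡⟨ cong₂ (λ x y → 8 * x + 3 * (K * (8 * y))) 8^n≡p³ 4^n≡p² ⟨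
  8 ^ K + 3 * (K * (8 * 4 ^ n))                ∎
  where
  open ≤-Reasoning
  arith₁ : ∀ p → (12 * p) * (12 * p) ≡ 144 * (p * p)
  arith₁ = solve-∀
  arith₂ : ∀ x → 144 * x + 16 * x ≡ 8 * (8 * x) + 3 * (4 * (8 * x))
  arith₂ = solve-∀
  arith₃ : ∀ p → 3 * (2 * p) + 3 * (2 * p) ≡ 12 * p
  arith₃ = solve-∀
  n K p U : ℕ
  n = 3 + r
  K = 4 + r
  p = 2 ^ n
  U = K * 9 + 3 * 2 ^ K
  4^n≡p² : 4 ^ n ≡ p * p
  4^n≡p² = [m*n]^k≡m^k*n^k 2 2 n
  8^n≡p³ : 8 ^ n ≡ p * (p * p)
  8^n≡p³ = trans ([m*n]^k≡m^k*n^k 2 4 n) (cong (p *_) 4^n≡p²)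
  8≤p : 8 ≤ p
  8≤p = ^-monoʳ-≤ 2 (m≤m+n 3 r)
  0<16p² : 0 < 16 * (p * p)
  0<16p² = ≤-trans (s≤s z≤n) (*-monoʳ-≤ 16 (*-mono-≤ (m^n>0 2 n) (m^n>0 2 n)))
  U≤12p : U ≤ 12 * p
  U≤12p = begin
    K * 9 + 3 * (2 * p)        ≡⟨ cong (_+ 3 * (2 * p)) (trans (*-comm K 9) (*-assoc 3 3 K)) ⟩
    3 * (3 * K) + 3 * (2 * p)  ≤⟨ +-monoˡ-≤ (3 * (2 * p)) (*-monoʳ-≤ 3 (3[4+r]≤2^[4+r] r)) ⟩
    3 * (2 * p) + 3 * (2 * p)  ≡⟨ arith₃ p ⟩
    12 * p                     ∎

-- The per-block counts (1 and 9 for rootOnly, 2 for rootAndLeg i, 8 for allLegs, 4 and 8 for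
-- legsExcept i) enter only through evaluation of the filters over allSubsets 9.
length-size3k+3Families : ∀ n → length (concatₗ (size3k+3Families (suc n))) ≡ 8 ^ suc n + 3 * (suc n * (8 * 4 ^ n))
length-size3k+3Families n = begin
  length (concatₗ (size3k+3Families (suc n)))
    ≡⟨ length-concat (size3k+3Families (suc n)) ⟩
  length (embeds allLegs (tuples (dominatedBlocks allLegs 3) (suc n))) + (E 0 + (E 1 + (E 2 + 0)))
    ≡⟨ cong₂ _+_ (trans (List.length-map _ (tuples (dominatedBlocks allLegs 3) (suc n))) (length-tuples (dominatedBlocks allLegs 3) (suc n)))
                 (cong₂ _+_ (exceptional 0 0<3) (cong₂ _+_ (exceptional 1 1<3) (cong (_+ 0) (exceptional 2 2<3)))) ⟩
  8 ^ suc n + (L + (L + (L + 0)))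
    ≡⟨⟩
  8 ^ suc n + 3 * L  ∎
  where
  open ≡-Reasoning
  L : ℕ
  L = suc n * (8 * 4 ^ n)
  E : ℕ → ℕ
  E i = length (embeds {suc n} (legsExcept i) (exceptionalFamily (suc n) i))
  exceptional : ∀ i → i < 3 → E i ≡ L
  exceptional 0 _ = trans (List.length-map _ (exceptionalFamily (suc n) 0))
    (length-tuplesWithOne (dominatedBlocks (legsExcept 0) 3) (dominatedBlocksWithX (legsExcept 0) 0 4) n)
  exceptional 1 _ = trans (List.length-map _ (exceptionalFamily (suc n) 1))
    (length-tuplesWithOne (dominatedBlocks (legsExcept 1) 3) (dominatedBlocksWithX (legsExcept 1) 1 4) n)
  exceptional 2 _ = trans (List.length-map _ (exceptionalFamily (suc n) 2))
    (length-tuplesWithOne (dominatedBlocks (legsExcept 2) 3) (dominatedBlocksWithX (legsExcept 2) 2 4) n)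
  exceptional (suc (suc (suc _))) (s≤s (s≤s (s≤s ())))

length-size3k+2Candidates : ∀ n → length (concatₗ (size3k+2Candidates (suc n))) ≡ suc n * 9 + 3 * 2 ^ suc n
length-size3k+2Candidates n = begin
  length (concatₗ (size3k+2Candidates (suc n)))
    ≡⟨ length-concat (size3k+2Candidates (suc n)) ⟩
  length (embeds rootOnly (tuplesWithOne B₀ B₁ (suc n))) + (R 0 + (R 1 + (R 2 + 0)))
    ≡⟨ cong₂ _+_ root-only (cong₂ _+_ (root-and-leg 0 0<3) (cong₂ _+_ (root-and-leg 1 1<3) (cong (_+ 0) (root-and-leg 2 2<3)))) ⟩
  suc n * 9 + (2 ^ suc n + (2 ^ suc n + (2 ^ suc n + 0)))
    ≡⟨⟩
  suc n * 9 + 3 * 2 ^ suc n  ∎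
  where
  open ≡-Reasoning
  B₀ B₁ : List (Vec Bool 9)
  B₀ = dominatedBlocks rootOnly 3
  B₁ = dominatedBlocks rootOnly 4
  R : ℕ → ℕ
  R i = length (embeds {suc n} (rootAndLeg i) (tuples (dominatedBlocks (rootAndLeg i) 3) (suc n)))
  root-only : length (embeds rootOnly (tuplesWithOne B₀ B₁ (suc n))) ≡ suc n * 9
  root-only = trans (List.length-map _ (tuplesWithOne B₀ B₁ (suc n)))
    (trans (length-tuplesWithOne B₀ B₁ n) (cong (λ x → suc n * (9 * x)) (^-zeroˡ n)))
  root-and-leg : ∀ i → i < 3 → R i ≡ 2 ^ suc n
  root-and-leg 0 _ = trans (List.length-map _ (tuples (dominatedBlocks (rootAndLeg 0) 3) (suc n))) (length-tuples _ (suc n))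
  root-and-leg 1 _ = trans (List.length-map _ (tuples (dominatedBlocks (rootAndLeg 1) 3) (suc n))) (length-tuples _ (suc n))
  root-and-leg 2 _ = trans (List.length-map _ (tuples (dominatedBlocks (rootAndLeg 2) 3) (suc n))) (length-tuples _ (suc n))
  root-and-leg (suc (suc (suc _))) (s≤s (s≤s (s≤s ())))

Tk-coefficient-bounds : ∀ n → let d = domCoeff (Tk (suc n)) in
  1 ≤ d (1 + suc n * 3) × d (2 + suc n * 3) ≤ suc n * 9 + 3 * 2 ^ suc n × 8 ^ suc n + 3 * (suc n * (8 * 4 ^ n)) ≤ d (3 + suc n * 3)
-- Tk (suc n) has 9 * suc n + 4 vertices, which is not definitionally 4 + suc n * 9;
-- abstracting over the vertex count lets the equation between them be matched with refl.
Tk-coefficient-bounds n = bounds (Tk (suc n)) (trans (+-comm (9 * suc n) 4) (cong (4 +_) (*-comm 9 (suc n)))) (λ _ _ → refl)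
  where
  bounds : ∀ {m} (G : Graph m) → m ≡ 4 + suc n * 9 → (∀ u v → adj G u v ≡ tadj (toℕ u) (toℕ v)) →
    1 ≤ domCoeff G (1 + suc n * 3) × domCoeff G (2 + suc n * 3) ≤ suc n * 9 + 3 * 2 ^ suc n ×
    8 ^ suc n + 3 * (suc n * (8 * 4 ^ n)) ≤ domCoeff G (3 + suc n * 3)
  bounds G refl adj≡tadj =
    1≤domCoeff[3k+1] ,
    subst (domCoeff G (2 + suc n * 3) ≤_) (length-size3k+2Candidates n) domCoeff≤length-size3k+2Candidates ,
    subst (_≤ domCoeff G (3 + suc n * 3)) (length-size3k+3Families n) length-size3k+3Families≤domCoeff
    where open Counting {suc n} G adj≡tadj

2+k*3≤9*k+4∸1 : ∀ k → 2 + k * 3 ≤ 9 * k + 4 ∸ 1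
2+k*3≤9*k+4∸1 k = begin
  2 + k * 3      ≤⟨ s≤s (s≤s (*-monoʳ-≤ k {3} {9} (s≤s (s≤s (s≤s z≤n))))) ⟩
  2 + k * 9      ≤⟨ n≤1+n _ ⟩
  3 + k * 9      ≡⟨ cong (3 +_) (*-comm k 9) ⟩
  3 + 9 * k      ≡⟨ +-comm 3 (9 * k) ⟩
  9 * k + 3      ≡⟨ +-∸-assoc (9 * k) {4} {1} (s≤s z≤n) ⟨
  9 * k + 4 ∸ 1  ∎
  where open ≤-Reasoning

proposition1 : (k : ℕ) → 4 ≤ k → ¬ DomPolyLogConcave (Tk k)
proposition1 k (s≤s (s≤s (s≤s (s≤s {n = r} z≤n)))) log-concave =
  let minimum , middle , above = Tk-coefficient-bounds (3 + r) in
  log-concavity-fails minimum middle above (size3k+2Bound²<size3k+3Bound r)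
    (log-concave (2 + k * 3) (s≤s z≤n) (2+k*3≤9*k+4∸1 k))
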